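{- Let $m,n,r$ be positive integers with $0<m<n$ and $\gcd(m,n)=1$. (a) If a prime $p$ divides $D_{m,n,r}$, then $v_p(D_{m,n,r}) \leq \left\lfloor \frac{\log(nr)}{\log p} \right\rfloor$. (b) If $p$ is a prime greater than $(nr)^{1/2}$ which divides $D_{m,n,r}$, then $p^2 \nmid D_{m,n,r}$, and there exist an integer $l$ with $1 \leq l < n/2$, $\gcd(l,n)=1$, $lp \equiv -m \pmod n$, and a non-negative integer $A$ such that \[ \frac{nr+m+n}{nA+n-l} \leq p \leq \frac{nr-m}{nA+l}. \] Moreover, every prime $p > (nr+m)^{1/2}$ for which such $l$ and $A$ exist (with $1 \le l < n/2$, $\gcd(l,n)=1$, $lp\equiv -m \pmod n$ and the displayed inequalities) divides $D_{m,n,r}$.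
   Context: For positive integers $m,n,r$ with $\gcd(m,n)=1$, $Y_{m,n,r}(z) = {}_2F_1(-r,-r-m/n;1-m/n;z)$, a polynomial in $\mathbb{Q}[z]$, where ${}_2F_1(\alpha,\beta;\gamma;z) = 1 + \sum_{k\ge1} \frac{\alpha(\alpha+1)\cdots(\alpha+k-1)\,\beta(\beta+1)\cdots(\beta+k-1)}{\gamma(\gamma+1)\cdots(\gamma+k-1)\,k!} z^k$. $D_{m,n,r}$ is the smallest positive integer such that $D_{m,n,r}Y_{m,n,r}(z)$ has rational integer coefficients. $v_p(x)$ is the exponent of the prime $p$ in $x$. -}

module Defs where

open import Data.Nat as ℕ using (ℕ; zero; suc; _≤_; _<_)
open import Data.Nat.Divisibility using (_∣_)
open import Data.Integer as ℤ using (ℤ)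
open import Data.Rational as ℚ using (ℚ; 0ℚ; 1ℚ)
open import Data.Rational.Properties using (_≟_)
open import Data.Product using (_×_; ∃)
open import Relation.Nullary using (¬_; yes; no)
open import Relation.Binary.PropositionalEquality using (_≡_)

-- total division on ℚ (x / 0 := 0); only ever used with nonzero divisors
_÷'_ : ℚ → ℚ → ℚ
x ÷' y with y ≟ 0ℚ
... | yes _ = 0ℚ
... | no y≢0 = ℚ._÷_ x y {{ℚ.≢-nonZero y≢0}}

⟪_⟫ : ℤ → ℚ
⟪ z ⟫ = z ℚ./ 1

⟦_⟧ : ℕ → ℚ
⟦ k ⟧ = ⟪ ℤ.+ k ⟫

poch : ℚ → ℕ → ℚ
poch a zero = 1ℚ
poch a (suc k) = poch a k ℚ.* (a ℚ.+ ⟦ k ⟧)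

hypCoeff : ℚ → ℚ → ℚ → ℕ → ℚ
hypCoeff α β γ k = (poch α k ℚ.* poch β k) ÷' (poch γ k ℚ.* ⟦ k ℕ.! ⟧)

-- k-th coefficient of Y_{m,n,r}(z) = 2F1(-r, -r-m/n; 1-m/n; z)
Ycoeff : ℕ → ℕ → ℕ → ℕ → ℚ
Ycoeff m n r k =
  hypCoeff (ℚ.- ⟦ r ⟧) (ℚ.- ⟦ r ⟧ ℚ.- (⟦ m ⟧ ÷' ⟦ n ⟧)) (1ℚ ℚ.- (⟦ m ⟧ ÷' ⟦ n ⟧)) k

IsInt : ℚ → Set
IsInt q = ∃ λ (z : ℤ) → q ≡ ⟪ z ⟫

ClearsDenoms : ℕ → ℕ → ℕ → ℕ → Set
ClearsDenoms m n r d = ∀ k → IsInt (⟦ d ⟧ ℚ.* Ycoeff m n r k)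

IsD : ℕ → ℕ → ℕ → ℕ → Set
IsD m n r d = (0 < d) × ClearsDenoms m n r d
              × (∀ d' → 0 < d' → ClearsDenoms m n r d' → d ≤ d')

Valuation : ℕ → ℕ → ℕ → Set
Valuation p x e = (p ℕ.^ e ∣ x) × ¬ (p ℕ.^ suc e ∣ x)

-- ⌊ log x / log p ⌋ = e  (for p ≥ 2, x ≥ 1): p^e ≤ x < p^(e+1)
FloorLog : ℕ → ℕ → ℕ → Set
FloorLog p x e = (p ℕ.^ e ≤ x) × (x < p ℕ.^ suc e)

{-# OPTIONS --safe #-}
module Submission where

open import Defs
open import Data.Nat as ℕ using (ℕ; zero; suc; _+_; _*_; _∸_; _^_; _≤_; _<_; _⊓_; z≤n; s≤s; _≤?_; _<?_; _/_; _%_; _!; NonZero; NonTrivial; >-nonZero)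
open import Data.Nat.Properties
open import Data.Nat.DivMod using (m≡m%n+[m/n]*n; m%n<n)
open import Data.Nat.Divisibility
open import Data.Nat.GCD as GCD using (gcd; gcd[m,n]∣m; gcd[m,n]∣n; gcd-greatest)
open import Data.Nat.Coprimality as Coprimality using (Coprime; coprime-divisor; coprime-Bézout)
open import Data.Nat.Primality using (Prime; euclidsLemma; prime⇒irreducible; prime⇒nonZero; prime⇒nonTrivial)
open import Data.Nat.Induction using (<-rec)
open import Data.Nat.Tactic.RingSolver using (solve-∀)
open import Data.Integer as ℤ using (ℤ)
import Data.Integer.Properties as ℤ
open import Data.Rational as ℚ using (ℚ; mkℚ; 0ℚ; 1ℚ; ↥_)
import Data.Rational.Properties as ℚ
open import Data.Rational.Solver using (module +-*-Solver)
open import Data.Product using (_×_; ∃; ∃₂; _,_; proj₁; proj₂)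
open import Data.Sum using (inj₁; inj₂; [_,_]′)
open import Data.Empty using (⊥; ⊥-elim)
open import Function using (_⇔_; mk⇔; Equivalence; id)
open import Function.Construct.Composition using (_⇔-∘_)
open import Relation.Nullary using (¬_; Dec; yes; no; contradiction)
open import Relation.Nullary.Decidable using (_×-dec_)
open import Relation.Binary.PropositionalEquality

-- Multiplying numerator and denominator of the k-th coefficient of Y by n ^ k gives
-- P k / Q k with Q k = ∏ j<k (j+1)(n(j+1) − m) and P k = ∏ j<k (r−j)(n(r−j) + m), so D is the
-- least d with Q k ∣ d · P k for all k, and p ^ (f+1) ∤ D as soon as v_p (Q k) ≤ v_p (P k) + f.
-- Count, level by level, the factors divisible by q = p ^ (t+1): each of the four families runs
-- through an arithmetic progression, so the counts over k terms agree except in a last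
-- incomplete window of length k mod q. Hence every level costs at most one, and nothing once
-- q > n r; this gives (a), and p² ∤ D when p² > n r. At the level q = p the cost is one only if
-- the denominator window holds some a with p ∣ n a − m while neither numerator window holds a
-- multiple of p, which forces a ≤ r mod p < p − a: the condition of (b) for l = (n a − m) / p
-- and A = ⌊r / p⌋. Conversely, under that condition p ∣ Q a but p ∤ P a.

𝟙 : {A : Set} → Dec A → ℕ
𝟙 (yes _) = 1
𝟙 (no _) = 0

𝟙-cong : {A B : Set} (a : Dec A) (b : Dec B) → (A → B) → (B → A) → 𝟙 a ≡ 𝟙 b
𝟙-cong (yes _) (yes _) _ _ = refl
𝟙-cong (yes x) (no ¬y) f _ = ⊥-elim (¬y (f x))
𝟙-cong (no ¬x) (yes y) _ g = ⊥-elim (¬x (g y))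
𝟙-cong (no _) (no _) _ _ = refl

𝟙-yes : {A : Set} (a : Dec A) → A → 𝟙 a ≡ 1
𝟙-yes (yes _) _ = refl
𝟙-yes (no ¬x) x = ⊥-elim (¬x x)

𝟙-no : {A : Set} (a : Dec A) → ¬ A → 𝟙 a ≡ 0
𝟙-no (yes x) ¬x = ⊥-elim (¬x x)
𝟙-no (no _) _ = refl

𝟙-pos : {A : Set} (a : Dec A) → 0 < 𝟙 a → A
𝟙-pos (yes x) _ = x

∑< : ℕ → (ℕ → ℕ) → ℕ
∑< zero f = 0
∑< (suc k) f = ∑< k f + f k

syntax ∑< k (λ j → e) = ∑[ j < k ] e

∏< : ℕ → (ℕ → ℕ) → ℕ
∏< zero f = 1
∏< (suc k) f = ∏< k f * f k

syntax ∏< k (λ j → e) = ∏[ j < k ] e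

∑-cong : ∀ k {f g : ℕ → ℕ} → (∀ j → j < k → f j ≡ g j) → ∑< k f ≡ ∑< k g
∑-cong zero _ = refl
∑-cong (suc k) f≡g = cong₂ _+_ (∑-cong k λ j j<k → f≡g j (m<n⇒m<1+n j<k)) (f≡g k ≤-refl)

∑-mono-≤ : ∀ k {f g : ℕ → ℕ} → (∀ j → j < k → f j ≤ g j) → ∑< k f ≤ ∑< k g
∑-mono-≤ zero _ = z≤n
∑-mono-≤ (suc k) f≤g = +-mono-≤ (∑-mono-≤ k λ j j<k → f≤g j (m<n⇒m<1+n j<k)) (f≤g k ≤-refl)

∑-zero : ∀ k → ∑[ _ < k ] 0 ≡ 0
∑-zero zero = refl
∑-zero (suc k) = trans (+-identityʳ _) (∑-zero k)

∑-vanish : ∀ k {f : ℕ → ℕ} → (∀ j → j < k → f j ≡ 0) → ∑< k f ≡ 0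
∑-vanish k f≡0 = trans (∑-cong k f≡0) (∑-zero k)

∑-distrib-+ : ∀ k (f g : ℕ → ℕ) → ∑[ j < k ] (f j + g j) ≡ ∑< k f + ∑< k g
∑-distrib-+ zero f g = refl
∑-distrib-+ (suc k) f g rewrite ∑-distrib-+ k f g = interchange (∑< k f) (∑< k g) (f k) (g k)
  where
  interchange : ∀ a b c d → a + b + (c + d) ≡ a + c + (b + d)
  interchange = solve-∀

∑-++ : ∀ a b (f : ℕ → ℕ) → ∑< (a + b) f ≡ ∑< a f + ∑[ j < b ] f (a + j)
∑-++ a zero f = trans (cong (λ k → ∑< k f) (+-identityʳ a)) (sym (+-identityʳ _))
∑-++ a (suc b) f = begin
  ∑< (a + suc b) f                            ≡⟨ cong (λ k → ∑< k f) (+-suc a b) ⟩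
  ∑< (a + b) f + f (a + b)                    ≡⟨ cong (_+ f (a + b)) (∑-++ a b f) ⟩
  ∑< a f + ∑[ j < b ] f (a + j) + f (a + b)   ≡⟨ +-assoc (∑< a f) _ _ ⟩
  ∑< a f + ∑[ j < suc b ] f (a + j)           ∎
  where open ≡-Reasoning

∑-comm : ∀ k T (f : ℕ → ℕ → ℕ) → ∑[ j < k ] ∑[ t < T ] f j t ≡ ∑[ t < T ] ∑[ j < k ] f j t
∑-comm zero T f = sym (∑-zero T)
∑-comm (suc k) T f = begin
  ∑[ j < k ] ∑[ t < T ] f j t + ∑[ t < T ] f k t  ≡⟨ cong (_+ ∑[ t < T ] f k t) (∑-comm k T f) ⟩
  ∑[ t < T ] ∑[ j < k ] f j t + ∑[ t < T ] f k t  ≡⟨ ∑-distrib-+ T _ _ ⟨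
  ∑[ t < T ] ∑[ j < suc k ] f j t                 ∎
  where open ≡-Reasoning

∑-reverse : ∀ r k (f : ℕ → ℕ) → k ≤ r → ∑[ j < k ] f (r ∸ j) ≡ ∑[ j < k ] f (suc (r ∸ k) + j)
∑-reverse r zero f _ = refl
∑-reverse r (suc k) f k<r = begin
  ∑[ j < k ] f (r ∸ j) + f (r ∸ k)                      ≡⟨ cong (_+ f (r ∸ k)) (∑-reverse r k f (<⇒≤ k<r)) ⟩
  ∑[ j < k ] f (suc (r ∸ k) + j) + f (r ∸ k)            ≡⟨ +-comm _ (f (r ∸ k)) ⟩
  f (r ∸ k) + ∑[ j < k ] f (suc (r ∸ k) + j)
    ≡⟨ cong₂ _+_ (cong f (sym first)) (∑-cong k λ j _ → cong f (shifted j)) ⟩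
  ∑< 1 (λ j → f (start + j)) + ∑[ j < k ] f (start + (1 + j)) ≡⟨ ∑-++ 1 k (λ j → f (start + j)) ⟨
  ∑[ j < suc k ] f (start + j)                             ∎
  where
  open ≡-Reasoning
  start = suc (r ∸ suc k)
  start≡r∸k : start ≡ r ∸ k
  start≡r∸k = sym (+-∸-assoc 1 k<r)
  first : start + 0 ≡ r ∸ k
  first = trans (+-identityʳ start) start≡r∸k
  shifted : ∀ j → suc (r ∸ k) + j ≡ start + (1 + j)
  shifted j = trans (cong (λ x → suc (x + j)) (sym start≡r∸k)) (sym (+-suc start j))

∑-𝟙-< : ∀ T f → ∑[ t < T ] 𝟙 (t <? f) ≡ T ⊓ f
∑-𝟙-< zero f = refl
∑-𝟙-< (suc T) f with T <? f
... | yes T<f = begin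
  ∑[ t < T ] 𝟙 (t <? f) + 1 ≡⟨ cong (_+ 1) (trans (∑-𝟙-< T f) (m≤n⇒m⊓n≡m (<⇒≤ T<f))) ⟩
  T + 1                     ≡⟨ +-comm T 1 ⟩
  suc T                     ≡⟨ m≤n⇒m⊓n≡m T<f ⟨
  suc T ⊓ f                 ∎
  where open ≡-Reasoning
... | no T≮f = begin
  ∑[ t < T ] 𝟙 (t <? f) + 0 ≡⟨ +-identityʳ _ ⟩
  ∑[ t < T ] 𝟙 (t <? f)     ≡⟨ ∑-𝟙-< T f ⟩
  T ⊓ f                     ≡⟨ m≥n⇒m⊓n≡n (≮⇒≥ T≮f) ⟩
  f                         ≡⟨ m≥n⇒m⊓n≡n (m≤n⇒m≤1+n (≮⇒≥ T≮f)) ⟨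
  suc T ⊓ f                 ∎
  where open ≡-Reasoning

∑-mono-≤-excess : ∀ T f {g h : ℕ → ℕ} → (∀ t → t < T → g t ≤ h t + 𝟙 (t <? f)) → ∑< T g ≤ ∑< T h + f
∑-mono-≤-excess T f {g} {h} g≤h = begin
  ∑< T g                                    ≤⟨ ∑-mono-≤ T g≤h ⟩
  ∑[ t < T ] (h t + 𝟙 (t <? f))             ≡⟨ ∑-distrib-+ T h _ ⟩
  ∑< T h + ∑[ t < T ] 𝟙 (t <? f)            ≡⟨ cong (∑< T h +_) (∑-𝟙-< T f) ⟩
  ∑< T h + T ⊓ f                            ≤⟨ +-monoʳ-≤ (∑< T h) (m⊓n≤n T f) ⟩
  ∑< T h + f                                ∎
  where open ≤-Reasoning

∑-pos⇒∃ : ∀ k (f : ℕ → ℕ) → 0 < ∑< k f → ∃ λ j → j < k × 0 < f j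
∑-pos⇒∃ (suc k) f pos with f k ℕ.≟ 0
... | no fk≢0 = k , ≤-refl , n≢0⇒n>0 fk≢0
... | yes fk≡0 with ∑-pos⇒∃ k f (subst (0 <_) (trans (cong (∑< k f +_) fk≡0) (+-identityʳ _)) pos)
...   | j , j<k , fj>0 = j , m<n⇒m<1+n j<k , fj>0

term≤∑ : ∀ k (f : ℕ → ℕ) j → j < k → f j ≤ ∑< k f
term≤∑ (suc k) f j j<1+k with j ℕ.≟ k
... | yes refl = m≤n+m _ _
... | no j≢k = ≤-trans (term≤∑ k f j (≤∧≢⇒< (≤-pred j<1+k) j≢k)) (m≤m+n _ _)

∏-pos : ∀ k {f : ℕ → ℕ} → (∀ j → j < k → 0 < f j) → 0 < ∏< k f
∏-pos zero _ = s≤s z≤n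
∏-pos (suc k) f>0 = *-pos (∏-pos k λ j j<k → f>0 j (m<n⇒m<1+n j<k)) (f>0 k ≤-refl)
  where
  *-pos : ∀ {x y} → 0 < x → 0 < y → 0 < x * y
  *-pos {suc _} {suc _} _ _ = s≤s z≤n

factor≤∏ : ∀ k {f : ℕ → ℕ} → (∀ j → j < k → 0 < f j) → ∀ j → j < k → f j ≤ ∏< k f
factor≤∏ (suc k) {f} f>0 j j<1+k with j ℕ.≟ k
... | yes refl = m≤n*m (f j) (∏< j f) {{>-nonZero (∏-pos j λ i i<j → f>0 i (m<n⇒m<1+n i<j))}}
... | no j≢k = ≤-trans (factor≤∏ k (λ i i<k → f>0 i (m<n⇒m<1+n i<k)) j (≤∧≢⇒< (≤-pred j<1+k) j≢k))
                      (m≤m*n (∏< k f) (f k) {{>-nonZero (f>0 k ≤-refl)}})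

∏-zero : ∀ k {f : ℕ → ℕ} j → j < k → f j ≡ 0 → ∏< k f ≡ 0
∏-zero (suc k) {f} j j<1+k fj≡0 with j ℕ.≟ k
... | yes refl = trans (cong (∏< j f *_) fj≡0) (*-zeroʳ (∏< j f))
... | no j≢k = cong (_* f k) (∏-zero k j (≤∧≢⇒< (≤-pred j<1+k) j≢k) fj≡0)

∣factor⇒∣∏ : ∀ k {f : ℕ → ℕ} {d} j → j < k → d ∣ f j → d ∣ ∏< k f
∣factor⇒∣∏ (suc k) {f} j j<1+k d∣fj with j ℕ.≟ k
... | yes refl = ∣n⇒∣m*n (∏< j f) d∣fj
... | no j≢k = ∣m⇒∣m*n (f k) (∣factor⇒∣∏ k j (≤∧≢⇒< (≤-pred j<1+k) j≢k) d∣fj)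

module Progression (q a c : ℕ) .{{_ : NonZero q}} (q⊥a : Coprime q a) where

  Hit : ℕ → Set
  Hit y = q ∣ a * y + c

  𝟙Hit : ℕ → ℕ
  𝟙Hit y = 𝟙 (q ∣? a * y + c)

  hits : ℕ → ℕ → ℕ
  hits x len = ∑[ j < len ] 𝟙Hit (x + j)

  hits-++ : ∀ x u v → hits x (u + v) ≡ hits x u + hits (x + u) v
  hits-++ x u v = trans (∑-++ u v _) (cong (hits x u +_) (∑-cong v λ j _ → cong 𝟙Hit (sym (+-assoc x u j))))

  𝟙Hit-periodic : ∀ y → 𝟙Hit (y + q) ≡ 𝟙Hit y
  𝟙Hit-periodic y = 𝟙-cong _ _
    (λ h → ∣m+n∣m⇒∣n (subst (q ∣_) (period a y q c) h) (n∣m*n a))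
    (λ h → subst (q ∣_) (sym (period a y q c)) (∣m∣n⇒∣m+n (n∣m*n a) h))
    where
    period : ∀ a y q c → a * (y + q) + c ≡ a * q + (a * y + c)
    period = solve-∀

  hits-suc : ∀ x → hits (suc x) q ≡ hits x q
  hits-suc x = +-cancelʳ-≡ (𝟙Hit x) _ _ (begin
    hits (suc x) q + 𝟙Hit x       ≡⟨ +-comm _ (𝟙Hit x) ⟩
    𝟙Hit x + hits (suc x) q       ≡⟨ cong₂ (λ y z → 𝟙Hit y + hits z q) (+-identityʳ x) (+-comm x 1) ⟨
    𝟙Hit (x + 0) + hits (x + 1) q ≡⟨ hits-++ x 1 q ⟨
    hits x (1 + q)                ≡⟨ cong (hits x) (+-comm 1 q) ⟩
    hits x (q + 1)                ≡⟨ hits-++ x q 1 ⟩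
    hits x q + 𝟙Hit (x + q + 0)   ≡⟨ cong (hits x q +_) (trans (cong 𝟙Hit (+-identityʳ _)) (𝟙Hit-periodic x)) ⟩
    hits x q + 𝟙Hit x             ∎)
    where open ≡-Reasoning

  hits-period-invariant : ∀ x y → hits x q ≡ hits y q
  hits-period-invariant x y = trans (from0 x) (sym (from0 y))
    where
    from0 : ∀ x → hits x q ≡ hits 0 q
    from0 zero = refl
    from0 (suc x) = trans (hits-suc x) (from0 x)

  Hit-cancel-multiple : ∀ s y → Hit (s * q + y) → Hit y
  Hit-cancel-multiple s y hit = ∣m+n∣m⇒∣n (subst (q ∣_) (split a s q y c) hit) (n∣m*n (a * s))
    where
    split : ∀ a s q y c → a * (s * q + y) + c ≡ a * s * q + (a * y + c)
    split = solve-∀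

  Hit-unique : ∀ y j → Hit y → Hit (y + suc j) → suc j < q → ⊥
  Hit-unique y j hit₁ hit₂ j<q = <⇒≱ j<q (∣⇒≤ (coprime-divisor q⊥a q∣a[1+j]))
    where
    split : ∀ a y j c → a * (y + suc j) + c ≡ (a * y + c) + a * suc j
    split = solve-∀
    q∣a[1+j] : q ∣ a * suc j
    q∣a[1+j] = ∣m+n∣m⇒∣n (subst (q ∣_) (split a y j c) hit₂) hit₁

  -- Bézout gives a x ≡ ±1 (mod q), so y = ∓ c x (mod q) solves a y + c ≡ 0 (mod q).
  some-Hit : ∃ Hit
  some-Hit with coprime-Bézout (Coprimality.sym q⊥a)
  ... | GCD.Bézout.+- x y eq = x * c * (q ∸ 1) , divides (c + c * y * (q ∸ 1)) (begin
    a * (x * c * (q ∸ 1)) + c               ≡⟨ reassoc a x c (q ∸ 1) ⟩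
    (x * a) * c * (q ∸ 1) + c               ≡⟨ cong (λ z → z * c * (q ∸ 1) + c) eq ⟨
    (1 + y * q) * c * (q ∸ 1) + c           ≡⟨ cong (λ z → (1 + y * z) * c * (q ∸ 1) + c) q≡1+[q∸1] ⟩
    (1 + y * suc (q ∸ 1)) * c * (q ∸ 1) + c ≡⟨ factor-q y c (q ∸ 1) ⟩
    (c + c * y * (q ∸ 1)) * suc (q ∸ 1)     ≡⟨ cong ((c + c * y * (q ∸ 1)) *_) q≡1+[q∸1] ⟨
    (c + c * y * (q ∸ 1)) * q               ∎)
    where
    open ≡-Reasoning
    q≡1+[q∸1] : q ≡ suc (q ∸ 1)
    q≡1+[q∸1] = sym (suc-pred q)
    reassoc : ∀ a x c r → a * (x * c * r) + c ≡ (x * a) * c * r + c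
    reassoc = solve-∀
    factor-q : ∀ y c r → (1 + y * suc r) * c * r + c ≡ (c + c * y * r) * suc r
    factor-q = solve-∀
  ... | GCD.Bézout.-+ x y eq = x * c , divides (c * y) (begin
    a * (x * c) + c  ≡⟨ factor-c a x c ⟩
    c * (1 + x * a)  ≡⟨ cong (c *_) eq ⟩
    c * (y * q)      ≡⟨ *-assoc c y q ⟨
    c * y * q        ∎)
    where
    open ≡-Reasoning
    factor-c : ∀ a x c → a * (x * c) + c ≡ c * (1 + x * a)
    factor-c = solve-∀

  hits-at-hit : ∀ y → Hit y → hits y q ≡ 1
  hits-at-hit y hit-y = begin
    hits y q                          ≡⟨ cong (hits y) q≡1+[q∸1] ⟩
    hits y (1 + (q ∸ 1))              ≡⟨ hits-++ y 1 (q ∸ 1) ⟩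
    𝟙Hit (y + 0) + hits (y + 1) (q ∸ 1)
      ≡⟨ cong₂ _+_ (𝟙-yes _ (subst Hit (sym (+-identityʳ y)) hit-y)) (∑-vanish (q ∸ 1) miss) ⟩
    1                                 ∎
    where
    open ≡-Reasoning
    q≡1+[q∸1] : q ≡ 1 + (q ∸ 1)
    q≡1+[q∸1] = sym (suc-pred q)
    miss : ∀ j → j < q ∸ 1 → 𝟙Hit (y + 1 + j) ≡ 0
    miss j j<q∸1 = 𝟙-no _ λ h → Hit-unique y j hit-y (subst Hit (+-assoc y 1 j) h)
      (subst (suc j <_) (sym q≡1+[q∸1]) (s≤s j<q∸1))

  hits-period : ∀ x → hits x q ≡ 1
  hits-period x = trans (hits-period-invariant x (proj₁ some-Hit))
    (hits-at-hit (proj₁ some-Hit) (proj₂ some-Hit))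

  hits-blocks : ∀ x s u → hits x (s * q + u) ≡ s + hits (x + s * q) u
  hits-blocks x zero u = cong (λ y → hits y u) (sym (+-identityʳ x))
  hits-blocks x (suc s) u = begin
    hits x (q + s * q + u)               ≡⟨ cong (hits x) (+-assoc q (s * q) u) ⟩
    hits x (q + (s * q + u))             ≡⟨ hits-++ x q (s * q + u) ⟩
    hits x q + hits (x + q) (s * q + u)  ≡⟨ cong₂ _+_ (hits-period x) (hits-blocks (x + q) s u) ⟩
    suc s + hits (x + q + s * q) u       ≡⟨ cong (λ y → suc s + hits y u) (+-assoc x q (s * q)) ⟩
    suc s + hits (x + (q + s * q)) u     ∎
    where open ≡-Reasoning

  hits-short : ∀ x u → u ≤ q → hits x u ≤ 1
  hits-short x u u≤q = begin
    hits x u                        ≤⟨ m≤m+n _ _ ⟩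
    hits x u + hits (x + u) (q ∸ u) ≡⟨ hits-++ x u (q ∸ u) ⟨
    hits x (u + (q ∸ u))            ≡⟨ cong (hits x) (m+[n∸m]≡n u≤q) ⟩
    hits x q                        ≡⟨ hits-period x ⟩
    1                               ∎
    where open ≤-Reasoning

  hits-witness : ∀ x u j → j < u → Hit (x + j) → 0 < hits x u
  hits-witness x u j j<u h = ≤-trans (≤-reflexive (sym (𝟙-yes _ h))) (term≤∑ u _ j j<u)

  hits-witness-from-end : ∀ x u i y → x + u ≡ suc (i + y) → i < u → Hit y → 0 < hits x u
  hits-witness-from-end x u i y x+u≡1+i+y i<u hit-y = hits-witness x u (u ∸ suc i) (∸-monoʳ-< (s≤s z≤n) i<u)
    (subst Hit (sym x+[u∸[1+i]]≡y) hit-y)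
    where
    x+[u∸[1+i]]≡y : x + (u ∸ suc i) ≡ y
    x+[u∸[1+i]]≡y = +-cancelʳ-≡ (suc i) _ _ (begin
      x + (u ∸ suc i) + suc i   ≡⟨ +-assoc x _ (suc i) ⟩
      x + (u ∸ suc i + suc i)   ≡⟨ cong (x +_) (m∸n+n≡m i<u) ⟩
      x + u                     ≡⟨ x+u≡1+i+y ⟩
      suc (i + y)               ≡⟨ cong suc (+-comm i y) ⟩
      suc (y + i)               ≡⟨ +-suc y i ⟨
      y + suc i                 ∎)
      where open ≡-Reasoning

  ∑𝟙≡hits : ∀ (f : ℕ → ℕ) x k → (∀ j → q ∣ f j → Hit (x + j)) → (∀ j → Hit (x + j) → q ∣ f j) →
    ∑[ j < k ] 𝟙 (q ∣? f j) ≡ hits x k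
  ∑𝟙≡hits f x k to from = ∑-cong k λ j _ → 𝟙-cong _ _ (to j) (from j)

∣∸⇔∣+*pred : ∀ q {X m} .{{_ : NonZero q}} → m ≤ X → q ∣ X ∸ m ⇔ q ∣ X + m * (q ∸ 1)
∣∸⇔∣+*pred q {X} {m} m≤X = mk⇔
  (λ q∣X∸m → subst (q ∣_) shift (∣m∣n⇒∣m+n q∣X∸m (n∣m*n m)))
  (λ q∣X+m[q-1] → ∣m+n∣m⇒∣n (subst (q ∣_) (trans (sym shift) (+-comm _ (m * q))) q∣X+m[q-1]) (n∣m*n m))
  where
  shift : X ∸ m + m * q ≡ X + m * (q ∸ 1)
  shift = begin
    X ∸ m + m * q              ≡⟨ cong (λ z → X ∸ m + m * z) (suc-pred q) ⟨
    X ∸ m + m * suc (q ∸ 1)    ≡⟨ reorder (X ∸ m) m (q ∸ 1) ⟩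
    (m + (X ∸ m)) + m * (q ∸ 1) ≡⟨ cong (_+ m * (q ∸ 1)) (m+[n∸m]≡n m≤X) ⟩
    X + m * (q ∸ 1)            ∎
    where
    open ≡-Reasoning
    reorder : ∀ y m r → y + m * suc r ≡ (m + y) + m * r
    reorder = solve-∀

-- v_p x counted level by level, which turns v_p of a product into a double sum.
ν : ℕ → ℕ → ℕ → ℕ
ν p T x = ∑[ t < T ] 𝟙 (p ^ suc t ∣? x)

module _ {p : ℕ} .{{_ : NonTrivial p}} where

  private instance
    p≢0 : NonZero p
    p≢0 = ℕ.nonTrivial⇒nonZero p

  1<p : 1 < p
  1<p = ℕ.nonTrivial⇒n>1 p

  n<p^n : ∀ n → n < p ^ n
  n<p^n zero = s≤s z≤n
  n<p^n (suc n) = ≤-<-trans (n<p^n n) (^-monoʳ-< p 1<p (n<1+n n))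

  p^-mono-∣ : ∀ {a b} → a ≤ b → p ^ a ∣ p ^ b
  p^-mono-∣ {a} {b} a≤b = divides (p ^ (b ∸ a)) (begin
    p ^ b                 ≡⟨ cong (p ^_) (m+[n∸m]≡n a≤b) ⟨
    p ^ (a + (b ∸ a))     ≡⟨ ^-distribˡ-+-* p a (b ∸ a) ⟩
    p ^ a * p ^ (b ∸ a)   ≡⟨ *-comm (p ^ a) _ ⟩
    p ^ (b ∸ a) * p ^ a   ∎)
    where open ≡-Reasoning

  record PowerSplit (x : ℕ) : Set where
    constructor powerSplit
    field
      exponent cofactor : ℕ
      split : x ≡ p ^ exponent * cofactor
      p∤cofactor : ¬ p ∣ cofactor

    cofactor∣ : cofactor ∣ x
    cofactor∣ = subst (cofactor ∣_) (sym split) (n∣m*n (p ^ exponent))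

    p^exponent∣ : p ^ exponent ∣ x
    p^exponent∣ = subst (p ^ exponent ∣_) (sym split) (m∣m*n _)

    p^∣⇒≤exponent : ∀ {s} → p ^ s ∣ x → s ≤ exponent
    p^∣⇒≤exponent {s} p^s∣x = ≮⇒≥ λ e<s →
      p∤cofactor (*-cancelˡ-∣ (p ^ exponent) {{m^n≢0 p exponent}} (p^[1+e]∣ e<s))
      where
      p^[1+e]∣ : exponent < s → p ^ exponent * p ∣ p ^ exponent * cofactor
      p^[1+e]∣ e<s = subst₂ _∣_ (*-comm p (p ^ exponent)) split (∣-trans (p^-mono-∣ e<s) p^s∣x)

    exponent≤ : ∀ {T} → x < p ^ T → exponent ≤ T
    exponent≤ {T} x<p^T = ≮⇒≥ λ T<e → <⇒≱ x<p^T (≤-trans (^-monoʳ-≤ p (<⇒≤ T<e)) p^e≤x)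
      where
      p^e≤x : p ^ exponent ≤ x
      p^e≤x = subst (p ^ exponent ≤_) (sym split) (m≤m*n (p ^ exponent) cofactor {{cofactor≢0}})
        where
        cofactor≢0 : NonZero cofactor
        cofactor≢0 = ℕ.≢-nonZero λ c≡0 → p∤cofactor (subst (p ∣_) (sym c≡0) (p ∣0))

  powerSplitOf : ∀ x → 0 < x → PowerSplit x
  powerSplitOf = <-rec (λ x → 0 < x → PowerSplit x) step
    where
    step : ∀ x → (∀ {y} → y < x → 0 < y → PowerSplit y) → 0 < x → PowerSplit x
    step x rec 0<x with p ∣? x
    ... | no p∤x = powerSplit 0 x (sym (*-identityˡ x)) p∤x
    ... | yes (divides y x≡y*p) = powerSplit (suc e) c x≡p^[1+e]*c p∤c
      where
      0<y : 0 < y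
      0<y = n≢0⇒n>0 λ y≡0 → <⇒≢ 0<x (sym (trans x≡y*p (cong (_* p) y≡0)))
      y<x : y < x
      y<x = subst (y <_) (sym x≡y*p) (m<m*n y p {{>-nonZero 0<y}} 1<p)
      open PowerSplit (rec y<x 0<y) renaming (exponent to e; cofactor to c; split to y≡p^e*c; p∤cofactor to p∤c)
      x≡p^[1+e]*c : x ≡ p ^ suc e * c
      x≡p^[1+e]*c = trans x≡y*p (trans (cong (_* p) y≡p^e*c) (reorder (p ^ e) c p))
        where
        reorder : ∀ a b c → a * b * c ≡ c * a * b
        reorder = solve-∀

  ν≡exponent : ∀ T {x} (S : PowerSplit x) → x < p ^ T → ν p T x ≡ PowerSplit.exponent S
  ν≡exponent T {x} S x<p^T = begin
    ν p T x                        ≡⟨ ∑-cong T (λ t _ → 𝟙-cong _ (t <? e) p^∣⇒≤exponent p^[1+t]∣) ⟩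
    ∑[ t < T ] 𝟙 (t <? e)          ≡⟨ ∑-𝟙-< T e ⟩
    T ⊓ e                          ≡⟨ m≥n⇒m⊓n≡n (exponent≤ x<p^T) ⟩
    e                              ∎
    where
    open ≡-Reasoning
    open PowerSplit S renaming (exponent to e)
    p^[1+t]∣ : ∀ {t} → t < e → p ^ suc t ∣ x
    p^[1+t]∣ t<e = ∣-trans (p^-mono-∣ t<e) p^exponent∣

  ν-≤⇒p^∣ : ∀ T {x y f j} → (Sx : PowerSplit x) → x < p ^ T → (Sy : PowerSplit y) → y < p ^ T →
    ν p T x ≤ ν p T y + f → p ^ j ∣ x → p ^ j ∣ p ^ f * y
  ν-≤⇒p^∣ T {x} {y} {f} {j} Sx x<p^T Sy y<p^T νx≤νy+f p^j∣x =
    subst (p ^ j ∣_) p^[f+ey]*cy≡p^f*y (∣m⇒∣m*n cy (p^-mono-∣ j≤f+ey))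
    where
    open PowerSplit Sy using () renaming (exponent to ey; cofactor to cy; split to y≡p^ey*cy)
    j≤f+ey : j ≤ f + ey
    j≤f+ey = ≤-trans (PowerSplit.p^∣⇒≤exponent Sx p^j∣x)
      (subst₂ _≤_ (ν≡exponent T Sx x<p^T) (trans (cong (_+ f) (ν≡exponent T Sy y<p^T)) (+-comm ey f)) νx≤νy+f)
    p^[f+ey]*cy≡p^f*y : p ^ (f + ey) * cy ≡ p ^ f * y
    p^[f+ey]*cy≡p^f*y = begin
      p ^ (f + ey) * cy     ≡⟨ cong (_* cy) (^-distribˡ-+-* p f ey) ⟩
      p ^ f * p ^ ey * cy   ≡⟨ *-assoc (p ^ f) _ _ ⟩
      p ^ f * (p ^ ey * cy) ≡⟨ cong (p ^ f *_) y≡p^ey*cy ⟨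
      p ^ f * y             ∎
      where open ≡-Reasoning

prime∤* : ∀ {p a b} → Prime p → ¬ p ∣ a → ¬ p ∣ b → ¬ p ∣ a * b
prime∤* {a = a} {b} p-prime p∤a p∤b p∣ab = [ p∤a , p∤b ]′ (euclidsLemma a b p-prime p∣ab)

prime∤∏ : ∀ {p} → Prime p → ∀ k {f : ℕ → ℕ} → (∀ j → j < k → ¬ p ∣ f j) → ¬ p ∣ ∏< k f
prime∤∏ p-prime zero _ p∣1 = <⇒≱ (ℕ.nonTrivial⇒n>1 _ {{prime⇒nonTrivial p-prime}}) (∣⇒≤ p∣1)
prime∤∏ p-prime (suc k) p∤f = prime∤* p-prime (prime∤∏ p-prime k λ j j<k → p∤f j (m<n⇒m<1+n j<k)) (p∤f k ≤-refl)

module _ {p : ℕ} (p-prime : Prime p) where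

  private instance
    p-nonTrivial : NonTrivial p
    p-nonTrivial = prime⇒nonTrivial p-prime

  PowerSplit-* : ∀ {x y} → PowerSplit {p} x → PowerSplit {p} y → PowerSplit {p} (x * y)
  PowerSplit-* (powerSplit a c x≡p^a*c p∤c) (powerSplit b d y≡p^b*d p∤d) =
    powerSplit (a + b) (c * d) xy≡ (prime∤* p-prime p∤c p∤d)
    where
    xy≡ : _ ≡ p ^ (a + b) * (c * d)
    xy≡ = trans (cong₂ _*_ x≡p^a*c y≡p^b*d)
      (trans (interchange (p ^ a) (p ^ b) c d) (cong (_* (c * d)) (sym (^-distribˡ-+-* p a b))))
      where
      interchange : ∀ u v c d → u * c * (v * d) ≡ u * v * (c * d)
      interchange = solve-∀

  ν-* : ∀ T {x y} → 0 < x → 0 < y → x * y < p ^ T → ν p T (x * y) ≡ ν p T x + ν p T y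
  ν-* T {x} {y} 0<x 0<y xy<p^T = trans (ν≡exponent T (PowerSplit-* Sx Sy) xy<p^T)
    (sym (cong₂ _+_ (ν≡exponent T Sx (≤-<-trans (m≤m*n x y {{>-nonZero 0<y}}) xy<p^T))
                    (ν≡exponent T Sy (≤-<-trans (m≤n*m y x {{>-nonZero 0<x}}) xy<p^T))))
    where
    Sx = powerSplitOf x 0<x
    Sy = powerSplitOf y 0<y

  ν-∏ : ∀ T k {f : ℕ → ℕ} → (∀ j → j < k → 0 < f j) → ∏< k f < p ^ T →
    ν p T (∏< k f) ≡ ∑[ j < k ] ν p T (f j)
  ν-∏ T zero _ _ = ∑-vanish T λ t _ → 𝟙-no _ λ p^[1+t]∣1 →
    <⇒≱ 1<p (≤-trans (m≤m*n p (p ^ t) {{m^n≢0 p t {{ℕ.nonTrivial⇒nonZero p}}}}) (∣⇒≤ p^[1+t]∣1))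
  ν-∏ T (suc k) {f} f>0 ∏<p^T = begin
    ν p T (∏< k f * f k)               ≡⟨ ν-* T (∏-pos k f>0′) (f>0 k ≤-refl) ∏<p^T ⟩
    ν p T (∏< k f) + ν p T (f k)       ≡⟨ cong (_+ ν p T (f k)) (ν-∏ T k f>0′ ∏k<p^T) ⟩
    ∑[ j < k ] ν p T (f j) + ν p T (f k) ∎
    where
    open ≡-Reasoning
    f>0′ : ∀ j → j < k → 0 < f j
    f>0′ j j<k = f>0 j (m<n⇒m<1+n j<k)
    ∏k<p^T : ∏< k f < p ^ T
    ∏k<p^T = ≤-<-trans (m≤m*n (∏< k f) (f k) {{>-nonZero (f>0 k ≤-refl)}}) ∏<p^T

  ν-∏-* : ∀ T k {a b : ℕ → ℕ} → (∀ j → j < k → 0 < a j) → (∀ j → j < k → 0 < b j) →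
    ∏[ j < k ] (a j * b j) < p ^ T →
    ν p T (∏[ j < k ] (a j * b j)) ≡
      ∑[ t < T ] (∑[ j < k ] 𝟙 (p ^ suc t ∣? a j) + ∑[ j < k ] 𝟙 (p ^ suc t ∣? b j))
  ν-∏-* T k {a} {b} a>0 b>0 ∏<p^T = begin
    ν p T (∏[ j < k ] (a j * b j))                  ≡⟨ ν-∏ T k ab>0 ∏<p^T ⟩
    ∑[ j < k ] ν p T (a j * b j)
      ≡⟨ ∑-cong k (λ j j<k → ν-* T (a>0 j j<k) (b>0 j j<k) (ab<p^T j j<k)) ⟩
    ∑[ j < k ] (ν p T (a j) + ν p T (b j))          ≡⟨ ∑-distrib-+ k _ _ ⟩
    ∑[ j < k ] ν p T (a j) + ∑[ j < k ] ν p T (b j) ≡⟨ cong₂ _+_ (∑-comm k T _) (∑-comm k T _) ⟩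
    ∑[ t < T ] ∑[ j < k ] 𝟙 (p ^ suc t ∣? a j) + ∑[ t < T ] ∑[ j < k ] 𝟙 (p ^ suc t ∣? b j)
      ≡⟨ ∑-distrib-+ T _ _ ⟨
    ∑[ t < T ] (∑[ j < k ] 𝟙 (p ^ suc t ∣? a j) + ∑[ j < k ] 𝟙 (p ^ suc t ∣? b j)) ∎
    where
    open ≡-Reasoning
    ab>0 : ∀ j → j < k → 0 < a j * b j
    ab>0 j j<k = ℕ.>-nonZero⁻¹ _ {{m*n≢0 (a j) (b j) {{>-nonZero (a>0 j j<k)}} {{>-nonZero (b>0 j j<k)}}}}
    ab<p^T : ∀ j → j < k → a j * b j < p ^ T
    ab<p^T j j<k = ≤-<-trans (factor≤∏ k ab>0 j j<k) ∏<p^T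

prime∤⇒coprime : ∀ {p n} → Prime p → ¬ p ∣ n → Coprime p n
prime∤⇒coprime p-prime p∤n (d∣p , d∣n) with prime⇒irreducible p-prime d∣p
... | inj₁ d≡1 = d≡1
... | inj₂ refl = ⊥-elim (p∤n d∣n)

coprime-*ˡ : ∀ {a b n} → Coprime a n → Coprime b n → Coprime (a * b) n
coprime-*ˡ {a} a⊥n b⊥n {d} (d∣ab , d∣n) = b⊥n (coprime-divisor d⊥a d∣ab , d∣n)
  where
  d⊥a : Coprime d a
  d⊥a (e∣d , e∣a) = a⊥n (e∣a , ∣-trans e∣d d∣n)

coprime-^ˡ : ∀ {a n} e → Coprime a n → Coprime (a ^ e) n
coprime-^ˡ zero _ = Coprimality.1-coprimeTo _
coprime-^ˡ (suc e) a⊥n = coprime-*ˡ a⊥n (coprime-^ˡ e a⊥n)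

coprime⇒*∣ : ∀ {a b x} → Coprime a b → a ∣ x → b ∣ x → a * b ∣ x
coprime⇒*∣ {a} {b} a⊥b (divides y x≡y*a) b∣x =
  subst (a * b ∣_) (trans (*-comm a y) (sym x≡y*a)) (*-monoʳ-∣ a b∣y)
  where
  b∣y : b ∣ y
  b∣y = coprime-divisor (Coprimality.sym a⊥b) (subst (b ∣_) (trans x≡y*a (*-comm y a)) b∣x)

module _ {p : ℕ} (p-prime : Prime p) (Q P : ℕ → ℕ) (Q>0 : ∀ k → 0 < Q k) where

  private instance
    p-nonTrivial : NonTrivial p
    p-nonTrivial = prime⇒nonTrivial p-prime

  -- If p ^ (1 + f) ∣ D then D / p still clears all denominators: the part of Q k prime to p
  -- divides (D / p) · P k, and its p-part divides p ^ f · P k.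
  p^[1+f]∤minimal : ∀ {D} f → 0 < D → (∀ k → Q k ∣ D * P k) →
    (∀ d → 0 < d → (∀ k → Q k ∣ d * P k) → D ≤ d) →
    (∀ k j → p ^ j ∣ Q k → p ^ j ∣ p ^ f * P k) → ¬ p ^ suc f ∣ D
  p^[1+f]∤minimal {D} f 0<D D-clears D-minimal p-part∣ (divides D₀ D≡D₀*p^[1+f]) =
    <⇒≱ d<D (D-minimal d 0<d d-clears)
    where
    d = D₀ * p ^ f
    D≡d*p : D ≡ d * p
    D≡d*p = trans D≡D₀*p^[1+f] (reorder D₀ p (p ^ f))
      where
      reorder : ∀ a p b → a * (p * b) ≡ a * b * p
      reorder = solve-∀
    0<d : 0 < d
    0<d = n≢0⇒n>0 λ d≡0 → <⇒≢ 0<D (sym (trans D≡d*p (cong (_* p) d≡0)))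
    d<D : d < D
    d<D = subst (d <_) (sym D≡d*p) (m<m*n d p {{>-nonZero 0<d}} (ℕ.nonTrivial⇒n>1 p))
    d-clears : ∀ k → Q k ∣ d * P k
    d-clears k = subst (_∣ d * P k) (sym split) (coprime⇒*∣ (coprime-^ˡ exponent p⊥c) p^e∣dP c∣dP)
      where
      open PowerSplit (powerSplitOf (Q k) (Q>0 k))
      p⊥c : Coprime p cofactor
      p⊥c = prime∤⇒coprime p-prime p∤cofactor
      c∣dP : cofactor ∣ d * P k
      c∣dP = coprime-divisor (Coprimality.sym p⊥c)
        (subst (cofactor ∣_) (trans (cong (_* P k) D≡d*p) (reorder d p (P k))) (∣-trans cofactor∣ (D-clears k)))
        where
        reorder : ∀ d p x → d * p * x ≡ p * (d * x)
        reorder = solve-∀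
      p^e∣dP : p ^ exponent ∣ d * P k
      p^e∣dP = subst (p ^ exponent ∣_) (sym (*-assoc D₀ (p ^ f) (P k)))
        (∣n⇒∣m*n D₀ (p-part∣ k exponent p^exponent∣))

scale-≤⇔ : ∀ n .{{_ : NonZero n}} {x y X Y c} → n * x ≡ X + c → n * y ≡ Y + c → X ≤ Y ⇔ x ≤ y
scale-≤⇔ n {x} {y} {X} {Y} {c} nx≡X+c ny≡Y+c = mk⇔
  (λ X≤Y → *-cancelˡ-≤ n (subst₂ _≤_ (sym nx≡X+c) (sym ny≡Y+c) (+-monoˡ-≤ c X≤Y)))
  (λ x≤y → +-cancelʳ-≤ c X Y (subst₂ _≤_ nx≡X+c ny≡Y+c (*-monoʳ-≤ n x≤y)))

2*m<n⇒m<n : ∀ {m n} → 2 * m < n → m < n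
2*m<n⇒m<n {m} 2m<n = ≤-<-trans (m≤m+n m (m + 0)) 2m<n

-- z / 1 normalises to a literal mkℚ z 0 _, on which the ℚ operations compute.
⟪⟫≡mkℚ : ∀ z → ⟪ z ⟫ ≡ mkℚ z 0 (Coprimality.sym (Coprimality.1-coprimeTo ℤ.∣ z ∣))
⟪⟫≡mkℚ z = ℚ.↥p/↧p≡p (mkℚ z 0 _)

⟪⟫-* : ∀ a b → ⟪ a ⟫ ℚ.* ⟪ b ⟫ ≡ ⟪ a ℤ.* b ⟫
⟪⟫-* a b = cong₂ ℚ._*_ (⟪⟫≡mkℚ a) (⟪⟫≡mkℚ b)

⟪⟫-+ : ∀ a b → ⟪ a ⟫ ℚ.+ ⟪ b ⟫ ≡ ⟪ a ℤ.+ b ⟫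
⟪⟫-+ a b = trans (cong₂ ℚ._+_ (⟪⟫≡mkℚ a) (⟪⟫≡mkℚ b))
  (cong₂ (λ x y → (x ℤ.+ y) ℚ./ 1) (ℤ.*-identityʳ a) (ℤ.*-identityʳ b))

⟪⟫-mono-≤ : ∀ {a b} → a ℤ.≤ b → ⟪ a ⟫ ℚ.≤ ⟪ b ⟫
⟪⟫-mono-≤ {a} {b} a≤b = subst₂ ℚ._≤_ (sym (⟪⟫≡mkℚ a)) (sym (⟪⟫≡mkℚ b))
  (ℚ.*≤* (subst₂ ℤ._≤_ (sym (ℤ.*-identityʳ a)) (sym (ℤ.*-identityʳ b)) a≤b))

⟪⟫-cancel-≤ : ∀ {a b} → ⟪ a ⟫ ℚ.≤ ⟪ b ⟫ → a ℤ.≤ b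
⟪⟫-cancel-≤ {a} {b} ⟪a⟫≤⟪b⟫ with subst₂ ℚ._≤_ (⟪⟫≡mkℚ a) (⟪⟫≡mkℚ b) ⟪a⟫≤⟪b⟫
... | ℚ.*≤* a*1≤b*1 = subst₂ ℤ._≤_ (ℤ.*-identityʳ a) (ℤ.*-identityʳ b) a*1≤b*1

⟪⟫-injective : ∀ {a b} → ⟪ a ⟫ ≡ ⟪ b ⟫ → a ≡ b
⟪⟫-injective {a} {b} ⟪a⟫≡⟪b⟫ = cong ↥_ (trans (sym (⟪⟫≡mkℚ a)) (trans ⟪a⟫≡⟪b⟫ (⟪⟫≡mkℚ b)))

⟦⟧-* : ∀ a b → ⟦ a ⟧ ℚ.* ⟦ b ⟧ ≡ ⟦ a * b ⟧
⟦⟧-* a b = trans (⟪⟫-* (ℤ.+ a) (ℤ.+ b)) (cong ⟪_⟫ (sym (ℤ.pos-* a b)))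

⟦⟧-+ : ∀ a b → ⟦ a ⟧ ℚ.+ ⟦ b ⟧ ≡ ⟦ a + b ⟧
⟦⟧-+ a b = trans (⟪⟫-+ (ℤ.+ a) (ℤ.+ b)) (cong ⟪_⟫ (sym (ℤ.pos-+ a b)))

⟦⟧-∸ : ∀ a b → b ≤ a → ⟦ a ∸ b ⟧ ≡ ⟦ a ⟧ ℚ.- ⟦ b ⟧
⟦⟧-∸ a b b≤a = trans (sym (+-cancel ⟦ a ∸ b ⟧ ⟦ b ⟧))
  (cong (ℚ._- ⟦ b ⟧) (trans (⟦⟧-+ (a ∸ b) b) (cong ⟦_⟧ (m∸n+n≡m b≤a))))
  where
  open +-*-Solver using (solve; _:=_; _:+_; _:-_)
  +-cancel : ∀ x y → x ℚ.+ y ℚ.- y ≡ x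
  +-cancel = solve 2 (λ x y → x :+ y :- y := x) refl

⟪+-+⟫≡⟦∸⟧ : ∀ a b → b ≤ a → ⟪ ℤ.+ a ℤ.- ℤ.+ b ⟫ ≡ ⟦ a ∸ b ⟧
⟪+-+⟫≡⟦∸⟧ a b b≤a = cong ⟪_⟫ (trans (ℤ.[+m]-[+n]≡m⊖n a b) (ℤ.⊖-≥ b≤a))

⟦⟧-≤⇔ : ∀ {a b} → ⟦ a ⟧ ℚ.≤ ⟦ b ⟧ ⇔ a ≤ b
⟦⟧-≤⇔ = mk⇔ (λ ⟦a⟧≤⟦b⟧ → ℤ.drop‿+≤+ (⟪⟫-cancel-≤ ⟦a⟧≤⟦b⟧)) (λ a≤b → ⟪⟫-mono-≤ (ℤ.+≤+ a≤b))

⟦⟧≢0 : ∀ {a} → 0 < a → ⟦ a ⟧ ≢ 0ℚ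
⟦⟧≢0 {suc a} _ ⟦1+a⟧≡0 with ⟪⟫-injective {ℤ.+ suc a} {ℤ.+ 0} ⟦1+a⟧≡0
... | ()

÷'-*-cancel : ∀ x {y} → y ≢ 0ℚ → (x ÷' y) ℚ.* y ≡ x
÷'-*-cancel x {y} y≢0 with y ℚ.≟ 0ℚ
... | yes y≡0 = contradiction y≡0 y≢0
... | no _ = begin
  x ℚ.* ℚ.1/ y ℚ.* y     ≡⟨ ℚ.*-assoc x _ y ⟩
  x ℚ.* (ℚ.1/ y ℚ.* y)   ≡⟨ cong (x ℚ.*_) (ℚ.*-inverseˡ y) ⟩
  x ℚ.* 1ℚ               ≡⟨ ℚ.*-identityʳ x ⟩
  x                      ∎
  where
  open ≡-Reasoning
  instance
    y-nonZero : ℚ.NonZero y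
    y-nonZero = ℚ.≢-nonZero y≢0

ℚ-*-cancelʳ-≡ : ∀ {a b} y → y ≢ 0ℚ → a ℚ.* y ≡ b ℚ.* y → a ≡ b
ℚ-*-cancelʳ-≡ {a} {b} y y≢0 ay≡by = trans (sym (undo a)) (trans (cong (ℚ._* ℚ.1/ y) ay≡by) (undo b))
  where
  instance
    y-nonZero : ℚ.NonZero y
    y-nonZero = ℚ.≢-nonZero y≢0
  undo : ∀ x → x ℚ.* y ℚ.* ℚ.1/ y ≡ x
  undo x = trans (ℚ.*-assoc x y _) (trans (cong (x ℚ.*_) (ℚ.*-inverseʳ y)) (ℚ.*-identityʳ x))

⟦⟧-positive : ∀ {a} → 0 < a → ℚ.Positive ⟦ a ⟧
⟦⟧-positive {suc a} _ = subst ℚ.Positive (sym (⟪⟫≡mkℚ (ℤ.+ suc a))) _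

module _ (X Y p : ℕ) (0<Y : 0 < Y) where

  private instance
    ⟦Y⟧-positive : ℚ.Positive ⟦ Y ⟧
    ⟦Y⟧-positive = ⟦⟧-positive 0<Y
    ⟦Y⟧-nonNegative : ℚ.NonNegative ⟦ Y ⟧
    ⟦Y⟧-nonNegative = ℚ.pos⇒nonNeg ⟦ Y ⟧

  private
    X÷Y*Y≡X : (⟦ X ⟧ ÷' ⟦ Y ⟧) ℚ.* ⟦ Y ⟧ ≡ ⟦ X ⟧
    X÷Y*Y≡X = ÷'-*-cancel ⟦ X ⟧ (⟦⟧≢0 0<Y)

  ÷'≤⇔ : (⟦ X ⟧ ÷' ⟦ Y ⟧) ℚ.≤ ⟦ p ⟧ ⇔ X ≤ p * Y
  ÷'≤⇔ = mk⇔
    (λ X÷Y≤p → Equivalence.to ⟦⟧-≤⇔ (subst₂ ℚ._≤_ X÷Y*Y≡X (⟦⟧-* p Y) (ℚ.*-monoʳ-≤-nonNeg ⟦ Y ⟧ X÷Y≤p)))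
    (λ X≤pY → ℚ.*-cancelʳ-≤-pos ⟦ Y ⟧
      (subst₂ ℚ._≤_ (sym X÷Y*Y≡X) (sym (⟦⟧-* p Y)) (Equivalence.from ⟦⟧-≤⇔ X≤pY)))

  ≤÷'⇔ : ⟦ p ⟧ ℚ.≤ (⟦ X ⟧ ÷' ⟦ Y ⟧) ⇔ p * Y ≤ X
  ≤÷'⇔ = mk⇔
    (λ p≤X÷Y → Equivalence.to ⟦⟧-≤⇔ (subst₂ ℚ._≤_ (⟦⟧-* p Y) X÷Y*Y≡X (ℚ.*-monoʳ-≤-nonNeg ⟦ Y ⟧ p≤X÷Y)))
    (λ pY≤X → ℚ.*-cancelʳ-≤-pos ⟦ Y ⟧
      (subst₂ ℚ._≤_ (sym (⟦⟧-* p Y)) (sym X÷Y*Y≡X) (Equivalence.from ⟦⟧-≤⇔ pY≤X)))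

⟦∏⟧ : ∀ K (F : ℕ → ℚ) (g : ℕ → ℕ) → F 0 ≡ 1ℚ → (∀ k → k < K → F (suc k) ≡ F k ℚ.* ⟦ g k ⟧) → F K ≡ ⟦ ∏< K g ⟧
⟦∏⟧ zero F g F0≡1 _ = F0≡1
⟦∏⟧ (suc K) F g F0≡1 step = begin
  F (suc K)                  ≡⟨ step K ≤-refl ⟩
  F K ℚ.* ⟦ g K ⟧            ≡⟨ cong (ℚ._* ⟦ g K ⟧) (⟦∏⟧ K F g F0≡1 λ k k<K → step k (m<n⇒m<1+n k<K)) ⟩
  ⟦ ∏< K g ⟧ ℚ.* ⟦ g K ⟧     ≡⟨ ⟦⟧-* (∏< K g) (g K) ⟩
  ⟦ ∏< K g * g K ⟧           ∎
  where open ≡-Reasoning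

poch-vanish : ∀ r d → poch (ℚ.- ⟦ r ⟧) (suc (d + r)) ≡ 0ℚ
poch-vanish r zero = trans (cong (poch (ℚ.- ⟦ r ⟧) r ℚ.*_) (ℚ.+-inverseˡ ⟦ r ⟧))
  (ℚ.*-zeroʳ (poch (ℚ.- ⟦ r ⟧) r))
poch-vanish r (suc d) = trans (cong (ℚ._* (ℚ.- ⟦ r ⟧ ℚ.+ ⟦ suc (d + r) ⟧)) (poch-vanish r d))
  (ℚ.*-zeroˡ (ℚ.- ⟦ r ⟧ ℚ.+ ⟦ suc (d + r) ⟧))

module Problem (m n r : ℕ) (0<m : 0 < m) (m<n : m < n) (0<r : 0 < r) (m⊥n : gcd m n ≡ 1) where

  private instance
    n≢0 : NonZero n
    n≢0 = >-nonZero (≤-<-trans z≤n m<n)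

  den₁ den₂ num₁ num₂ : ℕ → ℕ
  den₁ j = suc j
  den₂ j = n * suc j ∸ m
  num₁ j = r ∸ j
  num₂ j = n * (r ∸ j) + m

  -- Ycoeff m n r k = P k / Q k (Ycoeff*Q≡P)
  Q P : ℕ → ℕ
  Q k = ∏[ j < k ] (den₁ j * den₂ j)
  P k = ∏[ j < k ] (num₁ j * num₂ j)

  m≤n*[1+j] : ∀ j → m ≤ n * suc j
  m≤n*[1+j] j = ≤-trans (<⇒≤ m<n) (m≤m*n n (suc j))

  den₂>0 : ∀ j → 0 < den₂ j
  den₂>0 j = m<n⇒0<n∸m (≤-trans m<n (m≤m*n n (suc j)))

  num₂>0 : ∀ j → 0 < num₂ j
  num₂>0 j = ≤-trans 0<m (m≤n+m m _)

  count : (ℕ → ℕ) → ℕ → ℕ → ℕ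
  count f q k = ∑[ j < k ] 𝟙 (q ∣? f j)

  denCount numCount : ℕ → ℕ → ℕ
  denCount q k = count den₁ q k + count den₂ q k
  numCount q k = count num₁ q k + count num₂ q k

  -- q ∣ n a + m (q − 1) is q ∣ n a − m without truncated subtraction; for q = p prime this is
  -- the condition of (b) with l = (n a − m) / p and A = r / p (good⇒admissible).
  Good : (q : ℕ) .{{_ : NonZero q}} → ℕ → Set
  Good q a = 1 ≤ a × q ∣ n * a + m * (q ∸ 1) × a ≤ r % q × r % q + a < q

  Good? : ∀ q .{{_ : NonZero q}} a → Dec (Good q a)
  Good? q a = 1 ≤? a ×-dec q ∣? n * a + m * (q ∸ 1) ×-dec a ≤? r % q ×-dec r % q + a <? q

  module AtLevel (q : ℕ) .{{q≢0 : NonZero q}} (k : ℕ) (k≤r : k ≤ r) where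

    s u : ℕ
    s = k / q
    u = k % q

    k≡s*q+u : k ≡ s * q + u
    k≡s*q+u = trans (m≡m%n+[m/n]*n k q) (+-comm u (s * q))

    u<q : u < q
    u<q = m%n<n k q

    x₀ : ℕ
    x₀ = suc (r ∸ k) + s * q

    x₀+u≡1+r : x₀ + u ≡ suc r
    x₀+u≡1+r = begin
      suc (r ∸ k) + s * q + u    ≡⟨ +-assoc (suc (r ∸ k)) _ _ ⟩
      suc (r ∸ k + (s * q + u))  ≡⟨ cong (λ z → suc (r ∸ k + z)) k≡s*q+u ⟨
      suc (r ∸ k + k)            ≡⟨ cong suc (m∸n+n≡m k≤r) ⟩
      suc r                      ∎
      where open ≡-Reasoning

    ρ A : ℕ
    ρ = r % q
    A = r / q

    x₀+u≡1+ρ+A*q : x₀ + u ≡ suc (ρ + A * q)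
    x₀+u≡1+ρ+A*q = trans x₀+u≡1+r (cong suc (m≡m%n+[m/n]*n r q))

    q⊥1 : Coprime q 1
    q⊥1 (_ , d∣1) = ∣1⇒≡1 d∣1

    module Multiples = Progression q 1 0 q⊥1

    1*y+0≡y : ∀ y → 1 * y + 0 ≡ y
    1*y+0≡y y = trans (+-identityʳ _) (*-identityˡ y)

    count-multiples : ∀ x → ∑[ j < k ] 𝟙 (q ∣? x + j) ≡ Multiples.hits x k
    count-multiples x = Multiples.∑𝟙≡hits (x +_) x k
      (λ j → subst (q ∣_) (sym (1*y+0≡y (x + j)))) (λ j → subst (q ∣_) (1*y+0≡y (x + j)))

    count-den₁ : count den₁ q k ≡ s
    count-den₁ = begin
      count den₁ q k                        ≡⟨ count-multiples 1 ⟩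
      Multiples.hits 1 k                    ≡⟨ cong (Multiples.hits 1) k≡s*q+u ⟩
      Multiples.hits 1 (s * q + u)          ≡⟨ Multiples.hits-blocks 1 s u ⟩
      s + Multiples.hits (1 + s * q) u      ≡⟨ cong (s +_) (∑-vanish u λ j j<u → 𝟙-no _ (tail-miss j j<u)) ⟩
      s + 0                                 ≡⟨ +-identityʳ s ⟩
      s                                     ∎
      where
      open ≡-Reasoning
      tail-miss : ∀ j → j < u → ¬ q ∣ 1 * (1 + s * q + j) + 0
      tail-miss j j<u q∣ = >⇒∤ (≤-<-trans j<u u<q) (∣m+n∣m⇒∣n (subst (q ∣_) (reorder s q j) q∣) (n∣m*n s))
        where
        reorder : ∀ s q j → 1 * (1 + s * q + j) + 0 ≡ s * q + suc j
        reorder = solve-∀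

    count-num₁ : count num₁ q k ≡ s + Multiples.hits x₀ u
    count-num₁ = begin
      count num₁ q k                               ≡⟨ ∑-reverse r k (λ i → 𝟙 (q ∣? i)) k≤r ⟩
      ∑[ j < k ] 𝟙 (q ∣? suc (r ∸ k) + j)          ≡⟨ count-multiples (suc (r ∸ k)) ⟩
      Multiples.hits (suc (r ∸ k)) k               ≡⟨ cong (Multiples.hits (suc (r ∸ k))) k≡s*q+u ⟩
      Multiples.hits (suc (r ∸ k)) (s * q + u)     ≡⟨ Multiples.hits-blocks (suc (r ∸ k)) s u ⟩
      s + Multiples.hits x₀ u                      ∎
      where open ≡-Reasoning

    count-den₂≡0 : ∀ {p} → 1 < p → p ∣ q → p ∣ n → count den₂ q k ≡ 0
    count-den₂≡0 {p} 1<p p∣q p∣n = ∑-vanish k λ j _ → 𝟙-no _ λ q∣den₂ →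
      <⇒≱ 1<p (∣⇒≤ (subst (p ∣_) m⊥n (gcd-greatest (p∣m j (∣-trans p∣q q∣den₂)) p∣n)))
      where
      p∣m : ∀ j → p ∣ den₂ j → p ∣ m
      p∣m j p∣den₂ = ∣m+n∣m⇒∣n (subst (p ∣_) (sym (m∸n+n≡m (m≤n*[1+j] j))) (∣m⇒∣m*n (suc j) p∣n)) p∣den₂

    denCount≤numCount-if-∣n : ∀ {p} → 1 < p → p ∣ q → p ∣ n → denCount q k ≤ numCount q k
    denCount≤numCount-if-∣n 1<p p∣q p∣n = begin
      count den₁ q k + count den₂ q k   ≡⟨ cong₂ _+_ count-den₁ (count-den₂≡0 1<p p∣q p∣n) ⟩
      s + 0                             ≡⟨ +-identityʳ s ⟩
      s                                 ≤⟨ m≤m+n s _ ⟩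
      s + Multiples.hits x₀ u           ≡⟨ count-num₁ ⟨
      count num₁ q k                    ≤⟨ m≤m+n _ _ ⟩
      numCount q k                      ∎
      where open ≤-Reasoning

    denCount≡0 : n * r < q → denCount q k ≡ 0
    denCount≡0 nr<q = cong₂ _+_ (∑-vanish k λ j j<k → 𝟙-no _ (>⇒∤ (≤-<-trans (≤-trans j<k k≤n*r) nr<q)))
                                (∑-vanish k λ j j<k → 𝟙-no _ (>⇒∤ {{>-nonZero (den₂>0 j)}} (den₂<q j j<k)))
      where
      k≤n*r : k ≤ n * r
      k≤n*r = ≤-trans k≤r (m≤n*m r n)
      den₂<q : ∀ j → j < k → den₂ j < q
      den₂<q j j<k = ≤-<-trans (≤-trans (m∸n≤m _ m) (*-monoʳ-≤ n (≤-trans j<k k≤r))) nr<q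

    module Coprime-n (q⊥n : Coprime q n) where

      module Den₂ = Progression q n (m * (q ∸ 1)) q⊥n
      module Num₂ = Progression q n m q⊥n

      count-den₂ : count den₂ q k ≡ s + Den₂.hits (1 + s * q) u
      count-den₂ = begin
        count den₂ q k
          ≡⟨ Den₂.∑𝟙≡hits den₂ 1 k (λ j → Equivalence.to (shift j)) (λ j → Equivalence.from (shift j)) ⟩
        Den₂.hits 1 k                      ≡⟨ cong (Den₂.hits 1) k≡s*q+u ⟩
        Den₂.hits 1 (s * q + u)            ≡⟨ Den₂.hits-blocks 1 s u ⟩
        s + Den₂.hits (1 + s * q) u        ∎
        where
        open ≡-Reasoning
        shift : ∀ j → q ∣ den₂ j ⇔ q ∣ n * suc j + m * (q ∸ 1)
        shift j = ∣∸⇔∣+*pred q (m≤n*[1+j] j)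

      count-num₂ : count num₂ q k ≡ s + Num₂.hits x₀ u
      count-num₂ = begin
        count num₂ q k                           ≡⟨ ∑-reverse r k (λ i → 𝟙 (q ∣? n * i + m)) k≤r ⟩
        ∑[ j < k ] 𝟙 (q ∣? n * (suc (r ∸ k) + j) + m) ≡⟨ cong (Num₂.hits (suc (r ∸ k))) k≡s*q+u ⟩
        Num₂.hits (suc (r ∸ k)) (s * q + u)      ≡⟨ Num₂.hits-blocks (suc (r ∸ k)) s u ⟩
        s + Num₂.hits x₀ u                       ∎
        where open ≡-Reasoning

      denCount≤numCount+1 : denCount q k ≤ numCount q k + 1
      denCount≤numCount+1 = begin
        count den₁ q k + count den₂ q k                      ≡⟨ cong₂ _+_ count-den₁ count-den₂ ⟩
        s + (s + Den₂.hits (1 + s * q) u)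
          ≤⟨ +-monoʳ-≤ s (+-monoʳ-≤ s (Den₂.hits-short _ u (<⇒≤ u<q))) ⟩
        s + (s + 1)                                          ≡⟨ +-assoc s s 1 ⟨
        s + s + 1                                            ≤⟨ +-monoˡ-≤ 1 (+-mono-≤ (m≤m+n s _) (m≤m+n s _)) ⟩
        (s + Multiples.hits x₀ u) + (s + Num₂.hits x₀ u) + 1 ≡⟨ cong (_+ 1) (cong₂ _+_ count-num₁ count-num₂) ⟨
        numCount q k + 1                                     ∎
        where open ≤-Reasoning

      multiple-in-tail : ∀ {a} → ρ < a → a ≤ u → 0 < Multiples.hits x₀ u
      multiple-in-tail ρ<a a≤u = Multiples.hits-witness-from-end x₀ u ρ (A * q) x₀+u≡1+ρ+A*q (<-≤-trans ρ<a a≤u)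
        (subst (q ∣_) (sym (1*y+0≡y (A * q))) (n∣m*n A))

      num₂-hit-in-tail : ∀ {a} → a ≤ u → q ≤ ρ + a → Den₂.Hit a → 0 < Num₂.hits x₀ u
      num₂-hit-in-tail {a} a≤u q≤ρ+a hit-a =
        Num₂.hits-witness-from-end x₀ u z (A * q + w) x₀+u≡1+z+y (<-≤-trans z<a a≤u) hit-y
        where
        w = q ∸ a
        z = ρ + a ∸ q
        a+w≡q : a + w ≡ q
        a+w≡q = m+[n∸m]≡n (<⇒≤ (≤-<-trans a≤u u<q))
        ρ≡w+z : ρ ≡ w + z
        ρ≡w+z = +-cancelʳ-≡ a _ _ (begin
          ρ + a         ≡⟨ m+[n∸m]≡n q≤ρ+a ⟨
          q + z         ≡⟨ cong (_+ z) a+w≡q ⟨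
          a + w + z     ≡⟨ reorder a w z ⟩
          w + z + a     ∎)
          where
          open ≡-Reasoning
          reorder : ∀ a w z → a + w + z ≡ w + z + a
          reorder = solve-∀
        z<a : z < a
        z<a = +-cancelˡ-< w z a (subst₂ _<_ ρ≡w+z (trans (sym a+w≡q) (+-comm a w)) (m%n<n r q))
        x₀+u≡1+z+y : x₀ + u ≡ suc (z + (A * q + w))
        x₀+u≡1+z+y = trans x₀+u≡1+ρ+A*q (cong suc (trans (cong (_+ A * q) ρ≡w+z) (reorder w z (A * q))))
          where
          reorder : ∀ w z y → w + z + y ≡ z + (y + w)
          reorder = solve-∀
        hit-y : Num₂.Hit (A * q + w)
        hit-y = ∣m+n∣m⇒∣n (subst (q ∣_) (sym sum≡) (n∣m*n (n * A + n + m))) hit-a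
          where
          m+m*[q-1]≡m*q : m + m * (q ∸ 1) ≡ m * q
          m+m*[q-1]≡m*q = trans (sym (*-suc m (q ∸ 1))) (cong (m *_) (suc-pred q))
          sum≡ : n * a + m * (q ∸ 1) + (n * (A * q + w) + m) ≡ (n * A + n + m) * q
          sum≡ = begin
            n * a + m * (q ∸ 1) + (n * (A * q + w) + m)  ≡⟨ regroup n A q w m a (m * (q ∸ 1)) ⟩
            n * A * q + n * (a + w) + (m + m * (q ∸ 1))
              ≡⟨ cong₂ (λ x y → n * A * q + n * x + y) a+w≡q m+m*[q-1]≡m*q ⟩
            n * A * q + n * q + m * q                    ≡⟨ collect n A q m ⟩
            (n * A + n + m) * q                          ∎
            where
            open ≡-Reasoning
            regroup : ∀ n A q w m a c → n * a + c + (n * (A * q + w) + m) ≡ n * A * q + n * (a + w) + (m + c)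
            regroup = solve-∀
            collect : ∀ n A q m → n * A * q + n * q + m * q ≡ (n * A + n + m) * q
            collect = solve-∀

      -- The numerator tail window ends at r ≡ ρ (mod q). If ρ < a it contains a multiple of q;
      -- otherwise it contains r − (ρ + a − q), at which n(·) + m ≡ −(n a − m) ≡ 0 (mod q).
      tail-hit : ∀ a → a ≤ u → 1 ≤ a → Den₂.Hit a → ¬ Good q a → 0 < Multiples.hits x₀ u + Num₂.hits x₀ u
      tail-hit a a≤u 1≤a hit-a not-good = by-cases (ρ <? a)
        where
        by-cases : Dec (ρ < a) → 0 < Multiples.hits x₀ u + Num₂.hits x₀ u
        by-cases (yes ρ<a) = ≤-trans (multiple-in-tail ρ<a a≤u) (m≤m+n _ _)
        by-cases (no ρ≮a) =
          ≤-trans (num₂-hit-in-tail a≤u (≮⇒≥ λ ρ+a<q → not-good (1≤a , hit-a , ≮⇒≥ ρ≮a , ρ+a<q)) hit-a)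
          (m≤n+m _ _)

      denCount≤numCount-without-good : (∀ a → a < q → ¬ Good q a) → denCount q k ≤ numCount q k
      denCount≤numCount-without-good no-good = begin
        count den₁ q k + count den₂ q k                  ≡⟨ cong₂ _+_ count-den₁ count-den₂ ⟩
        s + (s + Den₂.hits (1 + s * q) u)                ≤⟨ +-monoʳ-≤ s (+-monoʳ-≤ s tail≤) ⟩
        s + (s + (Multiples.hits x₀ u + Num₂.hits x₀ u)) ≡⟨ interchange s _ _ ⟩
        (s + Multiples.hits x₀ u) + (s + Num₂.hits x₀ u) ≡⟨ cong₂ _+_ count-num₁ count-num₂ ⟨
        numCount q k                                     ∎
        where
        open ≤-Reasoning
        interchange : ∀ s a b → s + (s + (a + b)) ≡ (s + a) + (s + b)
        interchange = solve-∀
        tail≤ : Den₂.hits (1 + s * q) u ≤ Multiples.hits x₀ u + Num₂.hits x₀ u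
        tail≤ with Den₂.hits (1 + s * q) u ℕ.≟ 0
        ... | yes none = ≤-trans (≤-reflexive none) z≤n
        ... | no some with ∑-pos⇒∃ u _ (n≢0⇒n>0 some)
        ...   | j , j<u , hit = ≤-trans (Den₂.hits-short _ u (<⇒≤ u<q))
                  (tail-hit (suc j) j<u (s≤s z≤n) hit-1+j (no-good (suc j) (≤-<-trans j<u u<q)))
          where
          hit-1+j : Den₂.Hit (suc j)
          hit-1+j = Den₂.Hit-cancel-multiple s (suc j) (subst Den₂.Hit (reorder s q j) (𝟙-pos _ hit))
            where
            reorder : ∀ s q j → 1 + s * q + j ≡ s * q + suc j
            reorder = solve-∀

  Q>0 : ∀ k → 0 < Q k
  Q>0 k = ∏-pos k λ j _ → ℕ.>-nonZero⁻¹ _ {{m*n≢0 (suc j) (den₂ j) {{_}} {{>-nonZero (den₂>0 j)}}}}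

  P>0 : ∀ k → k ≤ r → 0 < P k
  P>0 k k≤r = ∏-pos k λ j j<k → ℕ.>-nonZero⁻¹ _
    {{m*n≢0 (r ∸ j) (num₂ j) {{>-nonZero (m<n⇒0<n∸m (<-≤-trans j<k k≤r))}} {{>-nonZero (num₂>0 j)}}}}

  P≡0 : ∀ k → r < k → P k ≡ 0
  P≡0 k r<k = ∏-zero k r r<k (cong (_* num₂ r) (n∸n≡0 r))

  LevelBound : ℕ → ℕ → Set
  LevelBound p f = ∀ k → k ≤ r → ∀ t → denCount (p ^ suc t) k ≤ numCount (p ^ suc t) k + 𝟙 (t <? f)

  p-part∣ : ∀ {p} → Prime p → ∀ f → LevelBound p f → ∀ k j → p ^ j ∣ Q k → p ^ j ∣ p ^ f * P k
  p-part∣ {p} p-prime f bound k j p^j∣Q with k ≤? r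
  ... | no k≰r =
    subst (p ^ j ∣_) (sym (trans (cong (p ^ f *_) (P≡0 k (≰⇒> k≰r))) (*-zeroʳ (p ^ f)))) (_∣0 (p ^ j))
  ... | yes k≤r =
    ν-≤⇒p^∣ T {j = j} (powerSplitOf (Q k) (Q>0 k)) Q<p^T (powerSplitOf (P k) (P>0 k k≤r)) P<p^T νQ≤νP+f p^j∣Q
    where
    instance
      p-nonTrivial : NonTrivial p
      p-nonTrivial = prime⇒nonTrivial p-prime
      p≢0 : NonZero p
      p≢0 = ℕ.nonTrivial⇒nonZero p
    T = Q k + P k
    Q<p^T : Q k < p ^ T
    Q<p^T = <-≤-trans (n<p^n (Q k)) (^-monoʳ-≤ p (m≤m+n (Q k) (P k)))
    P<p^T : P k < p ^ T
    P<p^T = <-≤-trans (n<p^n (P k)) (^-monoʳ-≤ p (m≤n+m (P k) (Q k)))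
    νQ≤νP+f : ν p T (Q k) ≤ ν p T (P k) + f
    νQ≤νP+f = subst₂ (λ x y → x ≤ y + f)
      (sym (ν-∏-* p-prime T k (λ j _ → s≤s z≤n) (λ j _ → den₂>0 j) Q<p^T))
      (sym (ν-∏-* p-prime T k (λ j j<k → m<n⇒0<n∸m (<-≤-trans j<k k≤r)) (λ j _ → num₂>0 j) P<p^T))
      (∑-mono-≤-excess T f (λ t _ → bound k k≤r t))

  module _ {p : ℕ} (p-prime : Prime p) where

    private instance
      p-nonTrivial : NonTrivial p
      p-nonTrivial = prime⇒nonTrivial p-prime
      p≢0 : NonZero p
      p≢0 = ℕ.nonTrivial⇒nonZero p

    p^[1+t]⊥n : ¬ p ∣ n → ∀ t → Coprime (p ^ suc t) n
    p^[1+t]⊥n p∤n t = coprime-^ˡ (suc t) (prime∤⇒coprime p-prime p∤n)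

    denCount≡0-above : ∀ {f} → n * r < p ^ suc f → ∀ k → k ≤ r → ∀ t → f ≤ t → denCount (p ^ suc t) k ≡ 0
    denCount≡0-above nr<p^[1+f] k k≤r t f≤t =
      AtLevel.denCount≡0 (p ^ suc t) {{m^n≢0 p (suc t)}} k k≤r (<-≤-trans nr<p^[1+f] (^-monoʳ-≤ p (s≤s f≤t)))

    levelBound : ∀ f → n * r < p ^ suc f → LevelBound p f
    levelBound f nr<p^[1+f] k k≤r t with t <? f
    ... | no t≮f = ≤-trans (≤-reflexive (denCount≡0-above nr<p^[1+f] k k≤r t (≮⇒≥ t≮f))) z≤n
    ... | yes _ with p ∣? n
    ...   | yes p∣n = ≤-trans
      (AtLevel.denCount≤numCount-if-∣n (p ^ suc t) {{m^n≢0 p (suc t)}} k k≤r 1<p (m∣m*n (p ^ t)) p∣n) (m≤m+n _ _)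
    ...   | no p∤n =
      AtLevel.Coprime-n.denCount≤numCount+1 (p ^ suc t) {{m^n≢0 p (suc t)}} k k≤r (p^[1+t]⊥n p∤n t)

    <p*p⇒<p^2 : ∀ {x} → x < p * p → x < p ^ 2
    <p*p⇒<p^2 {x} = subst (x <_) (cong (p *_) (sym (*-identityʳ p)))

    levelBound-without-good : n * r < p * p → (∀ a → a < p → ¬ Good p a) → LevelBound p 0
    levelBound-without-good nr<p*p no-good k k≤r (suc t) =
      ≤-trans (≤-reflexive (denCount≡0-above {1} (<p*p⇒<p^2 nr<p*p) k k≤r (suc t) (s≤s z≤n))) z≤n
    levelBound-without-good nr<p*p no-good k k≤r zero =
      subst (λ q → denCount q k ≤ numCount q k + 0) (sym (*-identityʳ p)) (≤-trans level-p (m≤m+n _ 0))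
      where
      level-p : denCount p k ≤ numCount p k
      level-p with p ∣? n
      ... | yes p∣n = AtLevel.denCount≤numCount-if-∣n p k k≤r 1<p ∣-refl p∣n
      ... | no p∤n =
        AtLevel.Coprime-n.denCount≤numCount-without-good p k k≤r (prime∤⇒coprime p-prime p∤n) no-good

  open +-*-Solver using (solve; _:=_; _:+_; _:*_; _:-_; :-_; con)

  μ α β γ : ℚ
  μ = ⟦ m ⟧ ÷' ⟦ n ⟧
  α = ℚ.- ⟦ r ⟧
  β = ℚ.- ⟦ r ⟧ ℚ.- μ
  γ = 1ℚ ℚ.- μ

  μ*n≡m : μ ℚ.* ⟦ n ⟧ ≡ ⟦ m ⟧
  μ*n≡m = ÷'-*-cancel ⟦ m ⟧ (⟦⟧≢0 (≤-<-trans z≤n m<n))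

  numerator-factor : ∀ k → k ≤ r → (α ℚ.+ ⟦ k ⟧) ℚ.* (β ℚ.+ ⟦ k ⟧) ℚ.* ⟦ n ⟧ ≡ ⟦ num₁ k * num₂ k ⟧
  numerator-factor k k≤r = begin
    (ℚ.- R ℚ.+ K) ℚ.* (ℚ.- R ℚ.- μ ℚ.+ K) ℚ.* N         ≡⟨ expand R K μ N ⟩
    (R ℚ.- K) ℚ.* (N ℚ.* (R ℚ.- K) ℚ.+ μ ℚ.* N)
      ≡⟨ cong₂ (λ a b → a ℚ.* (N ℚ.* a ℚ.+ b)) (sym (⟦⟧-∸ r k k≤r)) μ*n≡m ⟩
    ⟦ r ∸ k ⟧ ℚ.* (N ℚ.* ⟦ r ∸ k ⟧ ℚ.+ ⟦ m ⟧)
      ≡⟨ cong (λ a → ⟦ r ∸ k ⟧ ℚ.* (a ℚ.+ ⟦ m ⟧)) (⟦⟧-* n (r ∸ k)) ⟩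
    ⟦ r ∸ k ⟧ ℚ.* (⟦ n * (r ∸ k) ⟧ ℚ.+ ⟦ m ⟧)          ≡⟨ cong (⟦ r ∸ k ⟧ ℚ.*_) (⟦⟧-+ (n * (r ∸ k)) m) ⟩
    ⟦ r ∸ k ⟧ ℚ.* ⟦ num₂ k ⟧                           ≡⟨ ⟦⟧-* (r ∸ k) (num₂ k) ⟩
    ⟦ num₁ k * num₂ k ⟧                                ∎
    where
    open ≡-Reasoning
    R = ⟦ r ⟧
    K = ⟦ k ⟧
    N = ⟦ n ⟧
    expand : ∀ R K μ N →
      (ℚ.- R ℚ.+ K) ℚ.* (ℚ.- R ℚ.- μ ℚ.+ K) ℚ.* N ≡ (R ℚ.- K) ℚ.* (N ℚ.* (R ℚ.- K) ℚ.+ μ ℚ.* N)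
    expand = solve 4
      (λ R K μ N → (:- R :+ K) :* (:- R :- μ :+ K) :* N := (R :- K) :* (N :* (R :- K) :+ μ :* N)) refl

  denominator-factor : ∀ k → (γ ℚ.+ ⟦ k ⟧) ℚ.* ⟦ suc k ⟧ ℚ.* ⟦ n ⟧ ≡ ⟦ den₁ k * den₂ k ⟧
  denominator-factor k = begin
    (1ℚ ℚ.- μ ℚ.+ K) ℚ.* ⟦ suc k ⟧ ℚ.* N
      ≡⟨ cong (λ s → (1ℚ ℚ.- μ ℚ.+ K) ℚ.* s ℚ.* N) (sym (⟦⟧-+ 1 k)) ⟩
    (1ℚ ℚ.- μ ℚ.+ K) ℚ.* (1ℚ ℚ.+ K) ℚ.* N              ≡⟨ expand μ K N ⟩
    (1ℚ ℚ.+ K) ℚ.* (N ℚ.* (1ℚ ℚ.+ K) ℚ.- μ ℚ.* N)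
      ≡⟨ cong₂ (λ s b → s ℚ.* (N ℚ.* s ℚ.- b)) (⟦⟧-+ 1 k) μ*n≡m ⟩
    ⟦ suc k ⟧ ℚ.* (N ℚ.* ⟦ suc k ⟧ ℚ.- ⟦ m ⟧)
      ≡⟨ cong (λ a → ⟦ suc k ⟧ ℚ.* (a ℚ.- ⟦ m ⟧)) (⟦⟧-* n (suc k)) ⟩
    ⟦ suc k ⟧ ℚ.* (⟦ n * suc k ⟧ ℚ.- ⟦ m ⟧)
      ≡⟨ cong (⟦ suc k ⟧ ℚ.*_) (⟦⟧-∸ (n * suc k) m (m≤n*[1+j] k)) ⟨
    ⟦ suc k ⟧ ℚ.* ⟦ den₂ k ⟧                           ≡⟨ ⟦⟧-* (suc k) (den₂ k) ⟩
    ⟦ den₁ k * den₂ k ⟧                                ∎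
    where
    open ≡-Reasoning
    K = ⟦ k ⟧
    N = ⟦ n ⟧
    expand : ∀ μ K N → (1ℚ ℚ.- μ ℚ.+ K) ℚ.* (1ℚ ℚ.+ K) ℚ.* N ≡ (1ℚ ℚ.+ K) ℚ.* (N ℚ.* (1ℚ ℚ.+ K) ℚ.- μ ℚ.* N)
    expand = solve 3 (λ μ K N →
      (con 1ℚ :- μ :+ K) :* (con 1ℚ :+ K) :* N := (con 1ℚ :+ K) :* (N :* (con 1ℚ :+ K) :- μ :* N)) refl

  scaled-numerator-below : ∀ k → k ≤ r → poch α k ℚ.* poch β k ℚ.* ⟦ n ^ k ⟧ ≡ ⟦ P k ⟧
  scaled-numerator-below k k≤r = ⟦∏⟧ k (λ j → poch α j ℚ.* poch β j ℚ.* ⟦ n ^ j ⟧) _ refl step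
    where
    step : ∀ j → j < k → poch α (suc j) ℚ.* poch β (suc j) ℚ.* ⟦ n ^ suc j ⟧ ≡
                         poch α j ℚ.* poch β j ℚ.* ⟦ n ^ j ⟧ ℚ.* ⟦ num₁ j * num₂ j ⟧
    step j j<k = begin
      a₁ ℚ.* x₁ ℚ.* (a₂ ℚ.* x₂) ℚ.* ⟦ n * n ^ j ⟧
        ≡⟨ cong (a₁ ℚ.* x₁ ℚ.* (a₂ ℚ.* x₂) ℚ.*_) (⟦⟧-* n (n ^ j)) ⟨
      a₁ ℚ.* x₁ ℚ.* (a₂ ℚ.* x₂) ℚ.* (⟦ n ⟧ ℚ.* ⟦ n ^ j ⟧)  ≡⟨ regroup a₁ x₁ a₂ x₂ ⟦ n ⟧ ⟦ n ^ j ⟧ ⟩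
      a₁ ℚ.* a₂ ℚ.* ⟦ n ^ j ⟧ ℚ.* (x₁ ℚ.* x₂ ℚ.* ⟦ n ⟧)
        ≡⟨ cong (a₁ ℚ.* a₂ ℚ.* ⟦ n ^ j ⟧ ℚ.*_) (numerator-factor j j≤r) ⟩
      a₁ ℚ.* a₂ ℚ.* ⟦ n ^ j ⟧ ℚ.* ⟦ num₁ j * num₂ j ⟧      ∎
      where
      open ≡-Reasoning
      a₁ = poch α j
      a₂ = poch β j
      x₁ = α ℚ.+ ⟦ j ⟧
      x₂ = β ℚ.+ ⟦ j ⟧
      j≤r = <⇒≤ (<-≤-trans j<k k≤r)
      regroup : ∀ a x b y N Nj → a ℚ.* x ℚ.* (b ℚ.* y) ℚ.* (N ℚ.* Nj) ≡ a ℚ.* b ℚ.* Nj ℚ.* (x ℚ.* y ℚ.* N)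
      regroup = solve 6 (λ a x b y N Nj → a :* x :* (b :* y) :* (N :* Nj) := a :* b :* Nj :* (x :* y :* N)) refl

  scaled-numerator-above : ∀ k → r < k → poch α k ℚ.* poch β k ℚ.* ⟦ n ^ k ⟧ ≡ ⟦ P k ⟧
  scaled-numerator-above k r<k = begin
    poch α k ℚ.* poch β k ℚ.* ⟦ n ^ k ⟧   ≡⟨ cong (λ a → a ℚ.* poch β k ℚ.* ⟦ n ^ k ⟧) poch-α-k≡0 ⟩
    0ℚ ℚ.* poch β k ℚ.* ⟦ n ^ k ⟧        ≡⟨ cong (ℚ._* ⟦ n ^ k ⟧) (ℚ.*-zeroˡ (poch β k)) ⟩
    0ℚ ℚ.* ⟦ n ^ k ⟧                     ≡⟨ ℚ.*-zeroˡ ⟦ n ^ k ⟧ ⟩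
    0ℚ                                   ≡⟨ cong ⟦_⟧ (P≡0 k r<k) ⟨
    ⟦ P k ⟧                              ∎
    where
    open ≡-Reasoning
    poch-α-k≡0 : poch α k ≡ 0ℚ
    poch-α-k≡0 = trans (cong (poch α) (trans (sym (m∸n+n≡m r<k)) (+-suc (k ∸ suc r) r)))
      (poch-vanish r (k ∸ suc r))

  scaled-numerator : ∀ k → poch α k ℚ.* poch β k ℚ.* ⟦ n ^ k ⟧ ≡ ⟦ P k ⟧
  scaled-numerator k = by-cases (k ≤? r)
    where
    by-cases : Dec (k ≤ r) → poch α k ℚ.* poch β k ℚ.* ⟦ n ^ k ⟧ ≡ ⟦ P k ⟧
    by-cases (yes k≤r) = scaled-numerator-below k k≤r
    by-cases (no k≰r) = scaled-numerator-above k (≰⇒> k≰r)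

  scaled-denominator : ∀ k → poch γ k ℚ.* ⟦ k ! ⟧ ℚ.* ⟦ n ^ k ⟧ ≡ ⟦ Q k ⟧
  scaled-denominator k = ⟦∏⟧ k (λ j → poch γ j ℚ.* ⟦ j ! ⟧ ℚ.* ⟦ n ^ j ⟧) _ refl step
    where
    step : ∀ j → j < k → poch γ (suc j) ℚ.* ⟦ suc j ! ⟧ ℚ.* ⟦ n ^ suc j ⟧ ≡
                         poch γ j ℚ.* ⟦ j ! ⟧ ℚ.* ⟦ n ^ j ⟧ ℚ.* ⟦ den₁ j * den₂ j ⟧
    step j _ = begin
      c ℚ.* x ℚ.* ⟦ suc j * j ! ⟧ ℚ.* ⟦ n * n ^ j ⟧
        ≡⟨ cong₂ (λ u v → c ℚ.* x ℚ.* u ℚ.* v) (⟦⟧-* (suc j) (j !)) (⟦⟧-* n (n ^ j)) ⟨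
      c ℚ.* x ℚ.* (⟦ suc j ⟧ ℚ.* ⟦ j ! ⟧) ℚ.* (⟦ n ⟧ ℚ.* ⟦ n ^ j ⟧)
        ≡⟨ regroup c x ⟦ suc j ⟧ ⟦ j ! ⟧ ⟦ n ⟧ ⟦ n ^ j ⟧ ⟩
      c ℚ.* ⟦ j ! ⟧ ℚ.* ⟦ n ^ j ⟧ ℚ.* (x ℚ.* ⟦ suc j ⟧ ℚ.* ⟦ n ⟧)
        ≡⟨ cong (c ℚ.* ⟦ j ! ⟧ ℚ.* ⟦ n ^ j ⟧ ℚ.*_) (denominator-factor j) ⟩
      c ℚ.* ⟦ j ! ⟧ ℚ.* ⟦ n ^ j ⟧ ℚ.* ⟦ den₁ j * den₂ j ⟧             ∎
      where
      open ≡-Reasoning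
      c = poch γ j
      x = γ ℚ.+ ⟦ j ⟧
      regroup : ∀ a x S F N Nj → a ℚ.* x ℚ.* (S ℚ.* F) ℚ.* (N ℚ.* Nj) ≡ a ℚ.* F ℚ.* Nj ℚ.* (x ℚ.* S ℚ.* N)
      regroup = solve 6 (λ a x S F N Nj → a :* x :* (S :* F) :* (N :* Nj) := a :* F :* Nj :* (x :* S :* N)) refl

  Ycoeff*Q≡P : ∀ k → Ycoeff m n r k ℚ.* ⟦ Q k ⟧ ≡ ⟦ P k ⟧
  Ycoeff*Q≡P k = begin
    Ycoeff m n r k ℚ.* ⟦ Q k ⟧              ≡⟨ cong (Ycoeff m n r k ℚ.*_) (scaled-denominator k) ⟨
    Ycoeff m n r k ℚ.* (B ℚ.* ⟦ n ^ k ⟧)    ≡⟨ ℚ.*-assoc (Ycoeff m n r k) B _ ⟨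
    Ycoeff m n r k ℚ.* B ℚ.* ⟦ n ^ k ⟧      ≡⟨ cong (ℚ._* ⟦ n ^ k ⟧) (÷'-*-cancel (poch α k ℚ.* poch β k) B≢0) ⟩
    poch α k ℚ.* poch β k ℚ.* ⟦ n ^ k ⟧     ≡⟨ scaled-numerator k ⟩
    ⟦ P k ⟧                                 ∎
    where
    open ≡-Reasoning
    B = poch γ k ℚ.* ⟦ k ! ⟧
    B≢0 : B ≢ 0ℚ
    B≢0 B≡0 = ⟦⟧≢0 (Q>0 k)
      (trans (sym (scaled-denominator k)) (trans (cong (ℚ._* ⟦ n ^ k ⟧) B≡0) (ℚ.*-zeroˡ ⟦ n ^ k ⟧)))

  clears⇔ : ∀ d → ClearsDenoms m n r d ⇔ (∀ k → Q k ∣ d * P k)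
  clears⇔ d = mk⇔ to from
    where
    d*Y*Q≡d*P : ∀ k → ⟦ d ⟧ ℚ.* Ycoeff m n r k ℚ.* ⟦ Q k ⟧ ≡ ⟦ d * P k ⟧
    d*Y*Q≡d*P k = trans (ℚ.*-assoc ⟦ d ⟧ (Ycoeff m n r k) ⟦ Q k ⟧)
      (trans (cong (⟦ d ⟧ ℚ.*_) (Ycoeff*Q≡P k)) (⟦⟧-* d (P k)))
    to : ClearsDenoms m n r d → ∀ k → Q k ∣ d * P k
    to clears k = from-integer (clears k)
      where
      from-integer : IsInt (⟦ d ⟧ ℚ.* Ycoeff m n r k) → Q k ∣ d * P k
      from-integer (z , d*Y≡z) = divides ℤ.∣ z ∣ (sym (trans (sym (ℤ.abs-* z (ℤ.+ Q k))) (cong ℤ.∣_∣ z*Q≡d*P)))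
        where
        z*Q≡d*P : z ℤ.* ℤ.+ Q k ≡ ℤ.+ (d * P k)
        z*Q≡d*P = ⟪⟫-injective
          (trans (sym (⟪⟫-* z (ℤ.+ Q k))) (trans (cong (ℚ._* ⟦ Q k ⟧) (sym d*Y≡z)) (d*Y*Q≡d*P k)))
    from : (∀ k → Q k ∣ d * P k) → ClearsDenoms m n r d
    from Q∣dP k = to-integer (Q∣dP k)
      where
      to-integer : Q k ∣ d * P k → IsInt (⟦ d ⟧ ℚ.* Ycoeff m n r k)
      to-integer (divides c d*P≡c*Q) = ℤ.+ c , ℚ-*-cancelʳ-≡ ⟦ Q k ⟧ (⟦⟧≢0 (Q>0 k))
        (trans (d*Y*Q≡d*P k) (trans (cong ⟦_⟧ d*P≡c*Q) (sym (⟦⟧-* c (Q k)))))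

  Admissible : ℕ → ℕ → ℕ → Set
  Admissible p l A = 1 ≤ l × 2 * l < n × gcd l n ≡ 1 × n ∣ l * p + m
          × ((⟪ ℤ.+ (n * r + m + n) ⟫ ÷' ⟪ ℤ.+ (n * A + n) ℤ.- ℤ.+ l ⟫) ℚ.≤ ⟦ p ⟧)
          × (⟦ p ⟧ ℚ.≤ (⟪ ℤ.+ (n * r) ℤ.- ℤ.+ m ⟫ ÷' ⟦ n * A + l ⟧))

  Window : ℕ → ℕ → ℕ → Set
  Window p a A = p * A + a ≤ r × r + a < p * A + p

  m≤n*r : m ≤ n * r
  m≤n*r = ≤-trans (<⇒≤ m<n) (m≤m*n n r {{>-nonZero 0<r}})

  module _ (p l a A : ℕ) (na≡lp+m : n * a ≡ l * p + m) where

    lower-bound⇔ : l < n →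
      (⟪ ℤ.+ (n * r + m + n) ⟫ ÷' ⟪ ℤ.+ (n * A + n) ℤ.- ℤ.+ l ⟫) ℚ.≤ ⟦ p ⟧ ⇔ r + a < p * A + p
    lower-bound⇔ l<n = subst (λ y → (⟦ X ⟧ ÷' y) ℚ.≤ ⟦ p ⟧ ⇔ r + a < p * A + p) (sym ⟪nA+n-l⟫≡⟦Y⟧)
      (arith ⇔-∘ ÷'≤⇔ X Y p 0<Y)
      where
      X = n * r + m + n
      Y = n * A + n ∸ l
      l≤nA+n : l ≤ n * A + n
      l≤nA+n = ≤-trans (<⇒≤ l<n) (m≤n+m n (n * A))
      0<Y : 0 < Y
      0<Y = m<n⇒0<n∸m (<-≤-trans l<n (m≤n+m n (n * A)))
      ⟪nA+n-l⟫≡⟦Y⟧ : ⟪ ℤ.+ (n * A + n) ℤ.- ℤ.+ l ⟫ ≡ ⟦ Y ⟧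
      ⟪nA+n-l⟫≡⟦Y⟧ = ⟪+-+⟫≡⟦∸⟧ (n * A + n) l l≤nA+n
      arith : X ≤ p * Y ⇔ suc (r + a) ≤ p * A + p
      arith = scale-≤⇔ n lhs rhs
        where
        lhs : n * suc (r + a) ≡ X + l * p
        lhs = begin
          n * suc (r + a)          ≡⟨ expand n r a ⟩
          n * r + n + n * a        ≡⟨ cong (n * r + n +_) na≡lp+m ⟩
          n * r + n + (l * p + m)  ≡⟨ regroup (n * r) n (l * p) m ⟩
          X + l * p                ∎
          where
          open ≡-Reasoning
          expand : ∀ n r a → n * suc (r + a) ≡ n * r + n + n * a
          expand = solve-∀
          regroup : ∀ x n y m → x + n + (y + m) ≡ x + m + n + y
          regroup = solve-∀
        rhs : n * (p * A + p) ≡ p * Y + l * p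
        rhs = begin
          n * (p * A + p)          ≡⟨ expand n p A ⟩
          p * (n * A + n)          ≡⟨ cong (p *_) (m∸n+n≡m l≤nA+n) ⟨
          p * (Y + l)              ≡⟨ split p Y l ⟩
          p * Y + l * p            ∎
          where
          open ≡-Reasoning
          expand : ∀ n p A → n * (p * A + p) ≡ p * (n * A + n)
          expand = solve-∀
          split : ∀ p Y l → p * (Y + l) ≡ p * Y + l * p
          split = solve-∀

    upper-bound⇔ : 0 < l → ⟦ p ⟧ ℚ.≤ (⟪ ℤ.+ (n * r) ℤ.- ℤ.+ m ⟫ ÷' ⟦ n * A + l ⟧) ⇔ p * A + a ≤ r
    upper-bound⇔ 0<l = subst (λ x → ⟦ p ⟧ ℚ.≤ (x ÷' ⟦ n * A + l ⟧) ⇔ p * A + a ≤ r) (sym ⟪nr-m⟫≡⟦nr∸m⟧)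
      (arith ⇔-∘ ≤÷'⇔ (n * r ∸ m) (n * A + l) p 0<nA+l)
      where
      0<nA+l : 0 < n * A + l
      0<nA+l = <-≤-trans 0<l (m≤n+m l (n * A))
      ⟪nr-m⟫≡⟦nr∸m⟧ : ⟪ ℤ.+ (n * r) ℤ.- ℤ.+ m ⟫ ≡ ⟦ n * r ∸ m ⟧
      ⟪nr-m⟫≡⟦nr∸m⟧ = ⟪+-+⟫≡⟦∸⟧ (n * r) m m≤n*r
      arith : p * (n * A + l) ≤ n * r ∸ m ⇔ p * A + a ≤ r
      arith = scale-≤⇔ n lhs (sym (m∸n+n≡m m≤n*r))
        where
        lhs : n * (p * A + a) ≡ p * (n * A + l) + m
        lhs = begin
          n * (p * A + a)          ≡⟨ expand n p A a ⟩
          n * p * A + n * a        ≡⟨ cong (n * p * A +_) na≡lp+m ⟩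
          n * p * A + (l * p + m)  ≡⟨ regroup n p A l m ⟩
          p * (n * A + l) + m      ∎
          where
          open ≡-Reasoning
          expand : ∀ n p A a → n * (p * A + a) ≡ n * p * A + n * a
          expand = solve-∀
          regroup : ∀ n p A l m → n * p * A + (l * p + m) ≡ p * (n * A + l) + m
          regroup = solve-∀

  window⇒admissible : ∀ {p l a A} → 1 ≤ a → n * a ≡ l * p + m → Window p a A → Admissible p l A
  window⇒admissible {p} {l} {a} {A} 1≤a na≡lp+m (lower , upper) =
    1≤l , 2l<n , gcd[l,n]≡1 , divides a (trans (sym na≡lp+m) (*-comm n a)) ,
    Equivalence.from (lower-bound⇔ p l a A na≡lp+m (2*m<n⇒m<n 2l<n)) upper ,
    Equivalence.from (upper-bound⇔ p l a A na≡lp+m 1≤l) lower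
    where
    1≤l : 1 ≤ l
    1≤l = n≢0⇒n>0 λ l≡0 → <⇒≱ m<n (begin
      n            ≤⟨ m≤m*n n a {{>-nonZero 1≤a}} ⟩
      n * a        ≡⟨ na≡lp+m ⟩
      l * p + m    ≡⟨ cong (λ x → x * p + m) l≡0 ⟩
      m            ∎)
      where open ≤-Reasoning
    2a<p : 2 * a < p
    2a<p = +-cancelˡ-< (p * A) (2 * a) p (begin-strict
      p * A + 2 * a        ≡⟨ cong (λ x → p * A + (a + x)) (+-identityʳ a) ⟩
      p * A + (a + a)      ≡⟨ +-assoc (p * A) a a ⟨
      p * A + a + a        ≤⟨ +-monoˡ-≤ a lower ⟩
      r + a                <⟨ upper ⟩
      p * A + p            ∎)
      where open ≤-Reasoning
    2l<n : 2 * l < n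
    2l<n = *-cancelʳ-< p (2 * l) n (begin-strict
      2 * l * p      ≡⟨ *-assoc 2 l p ⟩
      2 * (l * p)    ≤⟨ *-monoʳ-≤ 2 (≤-trans (m≤m+n (l * p) m) (≤-reflexive (sym na≡lp+m))) ⟩
      2 * (n * a)    ≡⟨ *-assoc 2 n a ⟨
      2 * n * a      ≡⟨ cong (_* a) (*-comm 2 n) ⟩
      n * 2 * a      ≡⟨ *-assoc n 2 a ⟩
      n * (2 * a)    <⟨ *-monoʳ-< n 2a<p ⟩
      n * p          ∎)
      where open ≤-Reasoning
    gcd[l,n]≡1 : gcd l n ≡ 1
    gcd[l,n]≡1 = ∣1⇒≡1 (subst (gcd l n ∣_) m⊥n (gcd-greatest g∣m (gcd[m,n]∣n l n)))
      where
      g∣m : gcd l n ∣ m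
      g∣m = ∣m+n∣m⇒∣n (subst (gcd l n ∣_) na≡lp+m (∣m⇒∣m*n a (gcd[m,n]∣n l n))) (∣m⇒∣m*n p (gcd[m,n]∣m l n))

  admissible⇒window : ∀ {p l A} → Admissible p l A → ∃ λ a → 1 ≤ a × n * a ≡ l * p + m × Window p a A
  admissible⇒window {p} {l} {A} (1≤l , 2l<n , _ , divides a lp+m≡an , lower , upper) =
    a , 1≤a , na≡lp+m , Equivalence.to (upper-bound⇔ p l a A na≡lp+m 1≤l) upper ,
    Equivalence.to (lower-bound⇔ p l a A na≡lp+m (2*m<n⇒m<n 2l<n)) lower
    where
    na≡lp+m : n * a ≡ l * p + m
    na≡lp+m = trans (*-comm n a) (sym lp+m≡an)
    1≤a : 1 ≤ a
    1≤a = n≢0⇒n>0 λ a≡0 → <⇒≢ (≤-trans 0<m (m≤n+m m (l * p))) (sym (trans lp+m≡an (cong (_* n) a≡0)))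

  p∣Q : ∀ {p l a} → 1 ≤ a → n * a ≡ l * p + m → p ∣ Q a
  p∣Q {p} {l} {suc a-1} _ na≡lp+m = ∣factor⇒∣∏ (suc a-1) a-1 ≤-refl (∣n⇒∣m*n (suc a-1) p∣den₂)
    where
    p∣den₂ : p ∣ den₂ a-1
    p∣den₂ = subst (p ∣_) (trans (sym (m+n∸n≡m (l * p) m)) (cong (_∸ m) (sym na≡lp+m))) (n∣m*n l)

  p∤n : ∀ {p l a} → 1 < p → n * a ≡ l * p + m → ¬ p ∣ n
  p∤n {p} {l} {a} 1<p na≡lp+m p∣n = <⇒≱ 1<p (∣⇒≤ (subst (p ∣_) m⊥n (gcd-greatest p∣m p∣n)))
    where
    p∣m : p ∣ m
    p∣m = ∣m+n∣m⇒∣n (subst (p ∣_) na≡lp+m (∣m⇒∣m*n a p∣n)) (n∣m*n l)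

  p∤P : ∀ {p l a A} → Prime p → n * a ≡ l * p + m → Window p a A → ¬ p ∣ P a
  p∤P {p} {l} {a} {A} p-prime na≡lp+m (lower , upper) = prime∤∏ p-prime a p∤factor
    where
    ρ = r ∸ p * A
    r≡pA+ρ : r ≡ p * A + ρ
    r≡pA+ρ = sym (m+[n∸m]≡n (≤-trans (m≤m+n (p * A) a) lower))
    a≤ρ : a ≤ ρ
    a≤ρ = +-cancelˡ-≤ (p * A) a ρ (subst (p * A + a ≤_) r≡pA+ρ lower)
    ρ+a<p : ρ + a < p
    ρ+a<p = +-cancelˡ-< (p * A) (ρ + a) p
      (subst (_< p * A + p) (trans (cong (_+ a) r≡pA+ρ) (+-assoc (p * A) ρ a)) upper)
    module _ (j : ℕ) (j<a : j < a) where
      w = ρ ∸ j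
      r∸j≡pA+w : r ∸ j ≡ p * A + w
      r∸j≡pA+w = trans (cong (_∸ j) r≡pA+ρ) (+-∸-assoc (p * A) (≤-trans (<⇒≤ j<a) a≤ρ))
      w+a<p : w + a < p
      w+a<p = ≤-<-trans (+-monoˡ-≤ a (m∸n≤m ρ j)) ρ+a<p
      p∤num₁ : ¬ p ∣ num₁ j
      p∤num₁ p∣num₁ = >⇒∤ {{>-nonZero (m<n⇒0<n∸m (<-≤-trans j<a a≤ρ))}} (≤-<-trans (m≤m+n w a) w+a<p)
        (∣m+n∣m⇒∣n (subst (p ∣_) r∸j≡pA+w p∣num₁) (m∣m*n A))
      p∤num₂ : ¬ p ∣ num₂ j
      p∤num₂ p∣num₂ = prime∤* p-prime (p∤n {l = l} (ℕ.nonTrivial⇒n>1 p {{prime⇒nonTrivial p-prime}}) na≡lp+m)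
        (>⇒∤ {{>-nonZero (<-≤-trans (≤-<-trans z≤n j<a) (m≤n+m a w))}} w+a<p) p∣n[w+a]
        where
        sum≡ : num₂ j + l * p ≡ n * p * A + n * (w + a)
        sum≡ = begin
          n * (r ∸ j) + m + l * p     ≡⟨ regroup (n * (r ∸ j)) m (l * p) ⟩
          n * (r ∸ j) + (l * p + m)   ≡⟨ cong₂ (λ x y → n * x + y) r∸j≡pA+w (sym na≡lp+m) ⟩
          n * (p * A + w) + n * a     ≡⟨ expand n p A w a ⟩
          n * p * A + n * (w + a)     ∎
          where
          open ≡-Reasoning
          regroup : ∀ x m y → x + m + y ≡ x + (y + m)
          regroup = solve-∀
          expand : ∀ n p A w a → n * (p * A + w) + n * a ≡ n * p * A + n * (w + a)
          expand = solve-∀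
        p∣n[w+a] : p ∣ n * (w + a)
        p∣n[w+a] = ∣m+n∣m⇒∣n (subst (p ∣_) sum≡ (∣m∣n⇒∣m+n p∣num₂ (n∣m*n l))) (∣m⇒∣m*n A (n∣m*n n))
    p∤factor : ∀ j → j < a → ¬ p ∣ num₁ j * num₂ j
    p∤factor j j<a = prime∤* p-prime (p∤num₁ j j<a) (p∤num₂ j j<a)

  good⇒admissible : ∀ {p} .{{_ : NonZero p}} a → Good p a → ∃₂ λ l A → Admissible p l A
  good⇒admissible zero (() , _)
  good⇒admissible {p} (suc a) (_ , hit , a≤ρ , ρ+a<p) =
    admissible (Equivalence.from (∣∸⇔∣+*pred p (m≤n*[1+j] a)) hit)
    where
    r≡p[r/p]+ρ : r ≡ p * (r / p) + r % p
    r≡p[r/p]+ρ = trans (m≡m%n+[m/n]*n r p) (trans (+-comm (r % p) _) (cong (_+ r % p) (*-comm (r / p) p)))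
    lower : p * (r / p) + suc a ≤ r
    lower = subst (p * (r / p) + suc a ≤_) (sym r≡p[r/p]+ρ) (+-monoʳ-≤ (p * (r / p)) a≤ρ)
    upper : r + suc a < p * (r / p) + p
    upper = subst (λ x → x + suc a < p * (r / p) + p) (sym r≡p[r/p]+ρ)
      (subst (_< p * (r / p) + p) (sym (+-assoc (p * (r / p)) (r % p) (suc a))) (+-monoʳ-< (p * (r / p)) ρ+a<p))
    admissible : p ∣ n * suc a ∸ m → ∃₂ λ l A → Admissible p l A
    admissible (divides l na∸m≡lp) = l , r / p , window⇒admissible (s≤s z≤n) na≡lp+m (lower , upper)
      where
      na≡lp+m : n * suc a ≡ l * p + m
      na≡lp+m = trans (sym (m∸n+n≡m (m≤n*[1+j] a))) (cong (_+ m) na∸m≡lp)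

  module Denominator {D : ℕ} (isD : IsD m n r D) where

    Q∣D*P : ∀ k → Q k ∣ D * P k
    Q∣D*P = Equivalence.to (clears⇔ D) (proj₁ (proj₂ isD))

    p^[1+f]∤D : ∀ {p} → Prime p → ∀ f → LevelBound p f → ¬ p ^ suc f ∣ D
    p^[1+f]∤D p-prime f bound = p^[1+f]∤minimal p-prime Q P Q>0 f (proj₁ isD) Q∣D*P
      (λ d 0<d Q∣d*P → proj₂ (proj₂ isD) d 0<d (Equivalence.from (clears⇔ d) Q∣d*P))
      (p-part∣ p-prime f bound)

    valuation≤floorLog : ∀ {p e f} → Prime p → Valuation p D e → FloorLog p (n * r) f → e ≤ f
    valuation≤floorLog {f = f} p-prime (p^e∣D , _) (_ , nr<p^[1+f]) = ≮⇒≥ λ f<e →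
      p^[1+f]∤D p-prime f (levelBound p-prime f nr<p^[1+f])
        (∣-trans (p^-mono-∣ {{prime⇒nonTrivial p-prime}} f<e) p^e∣D)

    module _ {p} (p-prime : Prime p) (nr<p*p : n * r < p * p) where

      private instance
        p≢0 : NonZero p
        p≢0 = prime⇒nonZero p-prime

      p²∤D : ¬ p ^ 2 ∣ D
      p²∤D = p^[1+f]∤D p-prime 1 (levelBound p-prime 1 (<p*p⇒<p^2 p-prime nr<p*p))

      p∣D⇒admissible : p ∣ D → ∃₂ λ l A → Admissible p l A
      p∣D⇒admissible p∣D = from-search (anyUpTo? (Good? p) p)
        where
        from-search : Dec (∃ λ a → a < p × Good p a) → ∃₂ λ l A → Admissible p l A
        from-search (yes (a , _ , good)) = good⇒admissible a good
        from-search (no no-good) = ⊥-elim (p^[1+f]∤D p-prime 0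
          (levelBound-without-good p-prime nr<p*p λ a a<p good → no-good (a , a<p , good))
          (subst (_∣ D) (sym (*-identityʳ p)) p∣D))

    admissible⇒p∣D : ∀ {p l A} → Prime p → Admissible p l A → p ∣ D
    admissible⇒p∣D {p} {l} {A} p-prime admissible = from-window (admissible⇒window admissible)
      where
      from-window : ∃ (λ a → 1 ≤ a × n * a ≡ l * p + m × Window p a A) → p ∣ D
      from-window (a , 1≤a , na≡lp+m , window) =
        [ id , (λ p∣P → ⊥-elim (p∤P {l = l} {A = A} p-prime na≡lp+m window p∣P)) ]′
        (euclidsLemma D (P a) p-prime (∣-trans (p∣Q {l = l} 1≤a na≡lp+m) (Q∣D*P a)))

lemma3p3 : ∀ (m n r : ℕ) → 0 < m → m < n → 0 < r → gcd m n ≡ 1 →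
    ∀ (D : ℕ) → IsD m n r D →
    ((∀ p → Prime p → p ∣ D → ∀ e f → Valuation p D e → FloorLog p (n * r) f → e ≤ f)
    × (∀ p → Prime p → n * r < p * p → p ∣ D →
        ¬ (p ^ 2 ∣ D)
        × ∃₂ λ (l A : ℕ) → 1 ≤ l × 2 * l < n × gcd l n ≡ 1 × n ∣ l * p + m
          × ((⟪ ℤ.+ (n * r + m + n) ⟫ ÷' ⟪ ℤ.+ (n * A + n) ℤ.- ℤ.+ l ⟫) ℚ.≤ ⟦ p ⟧)
          × (⟦ p ⟧ ℚ.≤ (⟪ ℤ.+ (n * r) ℤ.- ℤ.+ m ⟫ ÷' ⟦ n * A + l ⟧)))
    × (∀ p → Prime p → n * r + m < p * p →
        (∃₂ λ (l A : ℕ) → 1 ≤ l × 2 * l < n × gcd l n ≡ 1 × n ∣ l * p + m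
          × ((⟪ ℤ.+ (n * r + m + n) ⟫ ÷' ⟪ ℤ.+ (n * A + n) ℤ.- ℤ.+ l ⟫) ℚ.≤ ⟦ p ⟧)
          × (⟦ p ⟧ ℚ.≤ (⟪ ℤ.+ (n * r) ℤ.- ℤ.+ m ⟫ ÷' ⟦ n * A + l ⟧))) →
        p ∣ D))
lemma3p3 m n r 0<m m<n 0<r m⊥n D isD =
  (λ p p-prime _ e f → valuation≤floorLog p-prime) ,
  (λ p p-prime nr<p*p p∣D → p²∤D p-prime nr<p*p , p∣D⇒admissible p-prime nr<p*p p∣D) ,
  (λ p p-prime _ (l , A , admissible) → admissible⇒p∣D p-prime admissible)
  where open Problem.Denominator m n r 0<m m<n 0<r m⊥n isD
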